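{- Let $p$ be a prime number and let $A_1, A_2, A_3 \subseteq \mathbb{Z}_p$ be any sets with $|A_1|\,|A_2|\,|A_3| \ge 40\, p^{5/2}$. Then the equation $a_1^2 + a_1 a_2 + a_3 = 0$ has a solution with $a_1 \in A_1$, $a_2 \in A_2$, $a_3 \in A_3$.
   Context: $\mathbb{Z}_p = \mathbb{Z}/p\mathbb{Z}$, and the equation is considered in $\mathbb{Z}_p$. -}

module Defs where

open import Data.Nat using (ℕ; _+_; _*_; _%_; _^_; NonZero)
open import Data.Nat.Primality using (Prime)
open import Data.Fin using (Fin; toℕ)

-- Elements of ℤ_p are represented by Fin p (canonical residues 0..p-1).
-- The expression a1^2 + a1*a2 + a3 evaluated in ℤ_p, as a residue in ℕ.
eqnValue : (p : ℕ) .{{_ : NonZero p}} → Fin p → Fin p → Fin p → ℕ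
eqnValue p a₁ a₂ a₃ = (toℕ a₁ ^ 2 + toℕ a₁ * toℕ a₂ + toℕ a₃) % p

module Submission where

-- Suppose there is no solution.  Let g = p 𝟙_{A₃} − |A₃|, a function of mean zero on ℤ_p, and
-- for a ≠ 0 let φ_a(x) = −a² − a x be the a₃ forced by a₁ = a, a₂ = x.  Keeping the larger of
-- the halves {0 < a < p/2} and {p/2 < a < p} of A₁ gives W ⊆ A₁ with |A₁| ≤ 2|W| + 1 and no
-- a + a' = 0 in W.  Then T(x) = Σ_{a ∈ W} g(φ_a x) equals −|W||A₃| on A₂, so Cauchy–Schwarz
-- gives (|A₂||W||A₃|)² ≤ |A₂| Σ_x T(x)² = |A₂| (|W| Σ g² + E), where E sums the correlations
-- Σ_x g(φ_a x) g(φ_b x) over pairs a ≠ b in W.  The substitution x = −a⁻¹u − a turns such a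
-- correlation into the sum of g(u) g(mu + c) along the line with slope m = b/a and intercept
-- c = ab − b²; distinct pairs give distinct lines, and as g has mean zero the squared sums over
-- all p² lines add up to p (Σ g²)².  A second Cauchy–Schwarz bounds E² by |W|² p (Σ g²)², and
-- with Σ g² ≤ p² |A₃| the two inequalities force |A₁||A₂||A₃| < 40 p^{5/2}.

module NaturalBounds where

  open import Data.Nat
  open import Data.Nat.Properties
  open import Data.Sum using (_⊎_; inj₁; inj₂)
  open import Relation.Binary.PropositionalEquality using (_≡_; sym; trans; cong; subst)
  open import Data.Nat.Tactic.RingSolver using (solve-∀)

  private
    square-mono : ∀ {m n} → m ≤ n → m * m ≤ n * n
    square-mono m≤n = *-mono-≤ m≤n m≤n

  -- (P ∸ a)² ≤ c is the root-free form of P ≤ a + √c.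
  excess-bound : ∀ a c P x → P * P ≤ a * P + x → x * x ≤ c * (P * P) → (P ∸ a) * (P ∸ a) ≤ c
  excess-bound a c P x P²≤ x²≤ with P ∸ a in eq
  ... | zero = z≤n
  ... | Y@(suc _) = *-cancelʳ-≤ (Y * Y) c (P * P) {{m*n≢0 P P}} (begin
    Y * Y * (P * P) ≡⟨ lemma Y P ⟩
    Y * P * (Y * P) ≤⟨ square-mono YP≤x ⟩
    x * x           ≤⟨ x²≤ ⟩
    c * (P * P)     ∎)
    where
    open ≤-Reasoning
    instance
      P≢0 : NonZero P
      P≢0 = >-nonZero (<-≤-trans (s≤s z≤n) (subst (_≤ P) eq (m∸n≤m P a)))
    lemma : ∀ Y P → Y * Y * (P * P) ≡ Y * P * (Y * P)
    lemma = solve-∀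
    P≡a+Y : P ≡ a + Y
    P≡a+Y = trans (sym (m+[n∸m]≡n {a} {P} (<⇒≤ (m∸n≢0⇒n<m λ P∸a≡0 → 1+n≢0 (trans (sym eq) P∸a≡0))))) (cong (a +_) eq)
    YP≤x : Y * P ≤ x
    YP≤x = +-cancelˡ-≤ (a * P) (Y * P) x (begin
      a * P + Y * P ≡⟨ sym (*-distribʳ-+ P a Y) ⟩
      (a + Y) * P   ≡⟨ cong (_* P) P≡a+Y ⟨
      P * P         ≤⟨ P²≤ ⟩
      a * P + x     ∎)

  module _ {p : ℕ} .{{_ : NonZero p}} where

    private
      p⁴≤p⁵ : p * p * (p * p) ≤ p ^ 5
      p⁴≤p⁵ = subst (p * p * (p * p) ≤_) (lemma p) (m≤m*n (p * p * (p * p)) p)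
        where lemma : ∀ p → p * p * (p * p) * p ≡ p * (p * (p * (p * (p * 1))))
              lemma = solve-∀

    -- In the application B = |A₂|, C = |A₃|, K = |W|, N₁ = |A₁|, g = Σ g² and e = |E|.
    product-bound : ∀ {B K C N₁ g e} →
      B * K * C * (B * K * C) ≤ B * K * g + B * e → e * e ≤ K * K * (p * g * g) → g ≤ p * p * C →
      N₁ ≤ 2 * K + 1 → B ≤ p → C ≤ p → N₁ * B * C * (N₁ * B * C) < 1600 * p ^ 5
    product-bound {B} {K} {C} {N₁} {g} {e} h₁ h₂ g≤ N₁≤ B≤p C≤p = by-cases (≤-total Y (p * p))
      where
      P x : ℕ
      P = B * K * C
      x = B * e
      P²≤ : P * P ≤ p * p * P + x
      P²≤ = ≤-trans h₁ (+-monoˡ-≤ x (begin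
        B * K * g           ≤⟨ *-monoʳ-≤ (B * K) g≤ ⟩
        B * K * (p * p * C) ≡⟨ lemma B K C p ⟩
        p * p * P           ∎))
        where
        open ≤-Reasoning
        lemma : ∀ B K C p → B * K * (p * p * C) ≡ p * p * (B * K * C)
        lemma = solve-∀
      x²≤ : x * x ≤ p ^ 5 * (P * P)
      x²≤ = begin
        x * x                                        ≡⟨ lemma₁ B e ⟩
        B * B * (e * e)                              ≤⟨ *-monoʳ-≤ (B * B) h₂ ⟩
        B * B * (K * K * (p * g * g))                ≤⟨ *-monoʳ-≤ (B * B) (*-monoʳ-≤ (K * K) (*-mono-≤ (*-monoʳ-≤ p g≤) g≤)) ⟩
        B * B * (K * K * (p * (p * p * C) * (p * p * C))) ≡⟨ lemma₂ B K C p ⟩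
        p ^ 5 * (P * P)                              ∎
        where
        open ≤-Reasoning
        lemma₁ : ∀ B e → B * e * (B * e) ≡ B * B * (e * e)
        lemma₁ = solve-∀
        lemma₂ : ∀ B K C p → B * B * (K * K * (p * (p * p * C) * (p * p * C))) ≡ p * (p * (p * (p * (p * 1)))) * (B * K * C * (B * K * C))
        lemma₂ = solve-∀
      Y : ℕ
      Y = P ∸ p * p
      Y²≤p⁵ : Y * Y ≤ p ^ 5
      Y²≤p⁵ = excess-bound (p * p) (p ^ 5) P x P²≤ x²≤
      N≤ : N₁ * B * C ≤ 2 * (p * p + Y) + p * p
      N≤ = begin
        N₁ * B * C              ≤⟨ *-monoˡ-≤ C (*-monoˡ-≤ B N₁≤) ⟩
        (2 * K + 1) * B * C     ≡⟨ lemma K B C ⟩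
        2 * P + B * C           ≤⟨ +-mono-≤ (*-monoʳ-≤ 2 (m≤n+m∸n P (p * p))) (*-mono-≤ B≤p C≤p) ⟩
        2 * (p * p + Y) + p * p ∎
        where
        open ≤-Reasoning
        lemma : ∀ K B C → (2 * K + 1) * B * C ≡ 2 * (B * K * C) + B * C
        lemma = solve-∀
      bounded-by : ∀ M → M * M ≤ p ^ 5 → Y ≤ M → p * p ≤ M → N₁ * B * C * (N₁ * B * C) < 1600 * p ^ 5
      bounded-by M M²≤ Y≤M p²≤M = begin-strict
        N₁ * B * C * (N₁ * B * C)  ≤⟨ square-mono (≤-trans N≤ (+-mono-≤ (*-monoʳ-≤ 2 (+-mono-≤ p²≤M Y≤M)) p²≤M)) ⟩
        (2 * (M + M) + M) * (2 * (M + M) + M) ≡⟨ lemma M ⟩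
        25 * (M * M)               ≤⟨ *-monoʳ-≤ 25 M²≤ ⟩
        25 * p ^ 5                 <⟨ *-monoˡ-< (p ^ 5) {{m^n≢0 p 5}} (m≤m+n 26 1574) ⟩
        1600 * p ^ 5               ∎
        where
        open ≤-Reasoning
        lemma : ∀ M → (2 * (M + M) + M) * (2 * (M + M) + M) ≡ 25 * (M * M)
        lemma = solve-∀
      by-cases : Y ≤ p * p ⊎ p * p ≤ Y → N₁ * B * C * (N₁ * B * C) < 1600 * p ^ 5
      by-cases (inj₁ Y≤p²) = bounded-by (p * p) p⁴≤p⁵ Y≤p² ≤-refl
      by-cases (inj₂ p²≤Y) = bounded-by Y Y²≤p⁵ ≤-refl p²≤Y

  1600≤p : ∀ {p N} .{{_ : NonZero p}} → N ≤ p * p * p → 1600 * p ^ 5 ≤ N * N → 1600 ≤ p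
  1600≤p {p} {N} N≤p³ 1600p⁵≤N² = *-cancelʳ-≤ 1600 p (p ^ 5) {{m^n≢0 p 5}} (begin
    1600 * p ^ 5            ≤⟨ 1600p⁵≤N² ⟩
    N * N                   ≤⟨ square-mono N≤p³ ⟩
    p * p * p * (p * p * p) ≡⟨ lemma p ⟩
    p * p ^ 5               ∎)
    where
    open ≤-Reasoning
    lemma : ∀ p → p * p * p * (p * p * p) ≡ p * (p * (p * (p * (p * (p * 1)))))
    lemma = solve-∀

module Proof where

  open import Data.Nat as ℕ using (ℕ; zero; suc; NonZero; _∸_; _^_)
  import Data.Nat.Properties as ℕ
  open import Data.Nat.Divisibility as ℕ∣ using (>⇒∤)
  open import Data.Nat.Primality using (Prime; prime; composite; prime⇒nonZero; euclidsLemma)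
  open import Data.Nat.Coprimality using (prime⇒coprime; coprime-Bézout)
  open import Data.Nat.GCD using (module Bézout)
  open import Data.Integer using (ℤ; +_; +0; +[1+_]; -[1+_]; _+_; _*_; -_; _-_; _≤_; _<_; 0ℤ; 1ℤ; +≤+; +<+; -≤+; nonNegative; _%ℕ_; _/ℕ_)
    renaming (∣_∣ to ∣_∣ᶻ)
  import Data.Integer.Properties as ℤ
  open import Data.Integer.DivMod using (n%ℕd<d; a≡a%ℕn+[a/ℕn]*n)
  open import Data.Integer.Divisibility.Signed using (_∣_; divides; ∣m∣n⇒∣m+n; ∣m⇒∣-m; ∣m⇒∣m*n; ∣n⇒∣m*n; ∣⇒∣ᵤ; ∣ᵤ⇒∣)
  open import Data.Integer.Tactic.RingSolver using (solve-∀)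
  open import Data.Fin using (Fin; zero; suc; toℕ; fromℕ<; _≟_)
  open import Data.Fin.Properties using (any?; suc-injective; 0≢1+n; toℕ<n; toℕ-fromℕ<; toℕ-injective)
  open import Data.Fin.Permutation using (permutation)
  open import Data.Fin.Subset using (Subset; inside; outside; ∣_∣; _∈_; _⊆_)
  open import Data.Fin.Subset.Properties using (_∈?_; ∣p∣≤n)
  open import Data.Vec using ([]; _∷_; tabulate)
  open import Data.Vec.Properties using (lookup∘tabulate; []=⇒lookup; lookup⇒[]=)
  open import Data.Bool using (if_then_else_)
  open import Data.Product using (Σ; ∃; _×_; _,_; proj₁; proj₂; uncurry)
  open import Data.Sum using (_⊎_; inj₁; inj₂; fromInj₁) renaming (map to ⊎-map)
  open import Data.Empty using (⊥-elim)
  open import Function using (_∘_; flip)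
  open import Relation.Nullary using (¬_; Dec; yes; no; does; contradiction)
  open import Relation.Nullary.Decidable using (map′; _×-dec_; ¬?)
  open import Relation.Binary using (Setoid; tri<; tri≈; tri>)
  import Relation.Binary.Reasoning.Setoid as SetoidReasoning
  open import Level using (0ℓ)
  open import Relation.Binary.PropositionalEquality using (_≡_; _≢_; refl; sym; trans; cong; cong₂; subst; subst₂; module ≡-Reasoning)
  open import Algebra.Properties.Semiring.Sum ℤ.+-*-semiring
  open import Defs using (eqnValue)
  open NaturalBounds using (product-bound)

  -- Finite sums and Iverson brackets

  square-nonneg : ∀ i → 0ℤ ≤ i * i
  square-nonneg +0       = +≤+ ℕ.z≤n
  square-nonneg +[1+ n ] = +≤+ ℕ.z≤n
  square-nonneg -[1+ n ] = +≤+ ℕ.z≤n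

  ∑-mono-≤ : ∀ {n} {f g : Fin n → ℤ} → (∀ i → f i ≤ g i) → ∑[ i < n ] f i ≤ ∑[ i < n ] g i
  ∑-mono-≤ {zero}  f≤g = ℤ.≤-refl
  ∑-mono-≤ {suc n} f≤g = ℤ.+-mono-≤ (f≤g zero) (∑-mono-≤ (f≤g ∘ suc))

  ∑-nonneg : ∀ {n} {f : Fin n → ℤ} → (∀ i → 0ℤ ≤ f i) → 0ℤ ≤ ∑[ i < n ] f i
  ∑-nonneg {n} {f} f≥0 = subst (_≤ sum f) (sum-replicate-zero n) (∑-mono-≤ f≥0)

  ∑-nonpos : ∀ {n} {f : Fin n → ℤ} → (∀ i → f i ≤ 0ℤ) → ∑[ i < n ] f i ≤ 0ℤ
  ∑-nonpos {n} {f} f≤0 = subst (sum f ≤_) (sum-replicate-zero n) (∑-mono-≤ f≤0)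

  ∑-const : ∀ n c → ∑[ i < n ] c ≡ + n * c
  ∑-const zero    c = refl
  ∑-const (suc n) c = trans (cong (_+_ c) (∑-const n c)) (lemma (+ n) c)
    where
    lemma : ∀ m c → c + m * c ≡ (1ℤ + m) * c
    lemma = solve-∀

  ∑*∑ : ∀ {m n} (f : Fin m → ℤ) (g : Fin n → ℤ) → ∑[ i < m ] f i * ∑[ j < n ] g j ≡ ∑[ i < m ] ∑[ j < n ] (f i * g j)
  ∑*∑ {m} {n} f g = trans (*-distribʳ-sum (∑[ j < n ] g j) f) (sum-cong-≗ λ i → *-distribˡ-sum (f i) g)

  *-distribˡ-∑∑ : ∀ {m n} c (F : Fin m → Fin n → ℤ) →
                  c * ∑[ i < m ] ∑[ j < n ] F i j ≡ ∑[ i < m ] ∑[ j < n ] (c * F i j)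
  *-distribˡ-∑∑ {n = n} c F = trans (*-distribˡ-sum c λ i → ∑[ j < n ] F i j) (sum-cong-≗ λ i → *-distribˡ-sum c (F i))

  ∑∑-comm : ∀ {m n} (F : Fin m → Fin m → Fin n → Fin n → ℤ) →
            ∑[ a < m ] ∑[ b < m ] ∑[ x < n ] ∑[ y < n ] F a b x y ≡ ∑[ x < n ] ∑[ y < n ] ∑[ a < m ] ∑[ b < m ] F a b x y
  ∑∑-comm {m} {n} F = begin
    ∑[ a < m ] ∑[ b < m ] ∑[ x < n ] ∑[ y < n ] F a b x y ≡⟨ sum-cong-≗ (λ a → ∑-comm λ b x → ∑[ y < n ] F a b x y) ⟩
    ∑[ a < m ] ∑[ x < n ] ∑[ b < m ] ∑[ y < n ] F a b x y ≡⟨ ∑-comm (λ a x → ∑[ b < m ] ∑[ y < n ] F a b x y) ⟩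
    ∑[ x < n ] ∑[ a < m ] ∑[ b < m ] ∑[ y < n ] F a b x y ≡⟨ sum-cong-≗ (λ x → sum-cong-≗ λ a → ∑-comm λ b y → F a b x y) ⟩
    ∑[ x < n ] ∑[ a < m ] ∑[ y < n ] ∑[ b < m ] F a b x y ≡⟨ sum-cong-≗ (λ x → ∑-comm λ a y → ∑[ b < m ] F a b x y) ⟩
    ∑[ x < n ] ∑[ y < n ] ∑[ a < m ] ∑[ b < m ] F a b x y ∎
    where open ≡-Reasoning

  ∑-pos⇒pos : ∀ {n} (f : Fin n → ℤ) → 0ℤ < ∑[ i < n ] f i → ∃ λ i → 0ℤ < f i
  ∑-pos⇒pos f ∑f>0 with any? (λ i → 0ℤ ℤ.<? f i)
  ... | yes found = found
  ... | no  none  = ⊥-elim (ℤ.<-irrefl refl (ℤ.<-≤-trans ∑f>0 (∑-nonpos (λ i → ℤ.≮⇒≥ (λ fi>0 → none (i , fi>0))))))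

  ∑-≤1 : ∀ {n} (f : Fin n → ℤ) → (∀ i → f i ≤ 1ℤ) →
         (∀ i j → 0ℤ < f i → 0ℤ < f j → i ≡ j) → ∑[ i < n ] f i ≤ 1ℤ
  ∑-≤1 {zero}  f f≤1 unique = +≤+ ℕ.z≤n
  ∑-≤1 {suc n} f f≤1 unique with 0ℤ ℤ.<? f zero
  ... | yes f₀>0 = ℤ.+-mono-≤ (f≤1 zero) (∑-nonpos λ i → ℤ.≮⇒≥ λ fi>0 → 0≢1+n (unique zero (suc i) f₀>0 fi>0))
  ... | no  f₀≯0 = ℤ.+-mono-≤ (ℤ.≮⇒≥ f₀≯0)
                     (∑-≤1 (f ∘ suc) (f≤1 ∘ suc) λ i j fi>0 fj>0 → suc-injective (unique (suc i) (suc j) fi>0 fj>0))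

  𝕀 : ∀ {a} {P : Set a} → Dec P → ℤ
  𝕀 d = if does d then 1ℤ else 0ℤ

  module _ {a} {P : Set a} where

    𝕀-yes : (d : Dec P) → P → 𝕀 d ≡ 1ℤ
    𝕀-yes (yes _) _ = refl
    𝕀-yes (no ¬p) p = ⊥-elim (¬p p)

    𝕀-pos : (d : Dec P) → 0ℤ < 𝕀 d → P
    𝕀-pos (yes p) _ = p
    𝕀-pos (no _) (+<+ ())

    𝕀-nonneg : (d : Dec P) → 0ℤ ≤ 𝕀 d
    𝕀-nonneg (yes _) = +≤+ ℕ.z≤n
    𝕀-nonneg (no _)  = ℤ.≤-refl

    𝕀-≤1 : (d : Dec P) → 𝕀 d ≤ 1ℤ
    𝕀-≤1 (yes _) = ℤ.≤-refl
    𝕀-≤1 (no _)  = +≤+ ℕ.z≤n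

    𝕀-idem : (d : Dec P) → 𝕀 d * 𝕀 d ≡ 𝕀 d
    𝕀-idem (yes _) = refl
    𝕀-idem (no _)  = refl

    𝕀-absorb : (d : Dec P) → ∀ t → 𝕀 d * (𝕀 d * t) ≡ 𝕀 d * t
    𝕀-absorb (yes _) t = cong (1ℤ *_) (ℤ.*-identityˡ t)
    𝕀-absorb (no _)  t = refl

    𝕀-*-cong : (d : Dec P) → ∀ {x y} → (P → x ≡ y) → 𝕀 d * x ≡ 𝕀 d * y
    𝕀-*-cong (yes p) x≡y = cong (1ℤ *_) (x≡y p)
    𝕀-*-cong (no _)  _   = refl

    𝕀-mask-square : (d : Dec P) → ∀ t → (𝕀 d * t) * (𝕀 d * t) ≡ 𝕀 d * (t * t)
    𝕀-mask-square (yes _) t = lemma t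
      where lemma : ∀ t → (1ℤ * t) * (1ℤ * t) ≡ 1ℤ * (t * t)
            lemma = solve-∀
    𝕀-mask-square (no _)  t = refl

    𝕀-mask-square-≤ : (d : Dec P) → ∀ t → (𝕀 d * t) * (𝕀 d * t) ≤ t * t
    𝕀-mask-square-≤ d@(yes _) t = ℤ.≤-reflexive (trans (𝕀-mask-square d t) (ℤ.*-identityˡ (t * t)))
    𝕀-mask-square-≤ (no _)  t = square-nonneg t

  𝕀-× : ∀ {a b} {P : Set a} {Q : Set b} (d : Dec P) (e : Dec Q) → 𝕀 (d ×-dec e) ≡ 𝕀 d * 𝕀 e
  𝕀-× (yes _) (yes _) = refl
  𝕀-× (yes _) (no _)  = refl
  𝕀-× (no _)  _       = refl

  δ : ∀ {n} → Fin n → Fin n → ℤ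
  δ i j = 𝕀 (i ≟ j)

  ∑-δ : ∀ {n} (i : Fin n) (h : Fin n → ℤ) → ∑[ j < n ] (δ i j * h j) ≡ h i
  ∑-δ {suc n} zero    h = begin
    1ℤ * h zero + ∑[ j < n ] 0ℤ ≡⟨ cong₂ _+_ (ℤ.*-identityˡ (h zero)) (sum-replicate-zero n) ⟩
    h zero + 0ℤ                 ≡⟨ ℤ.+-identityʳ (h zero) ⟩
    h zero                      ∎
    where open ≡-Reasoning
  ∑-δ {suc n} (suc i) h = trans (ℤ.+-identityˡ _) (∑-δ i (h ∘ suc))

  𝟙 : ∀ {n} → Subset n → Fin n → ℤ
  𝟙 A i = 𝕀 (i ∈? A)

  ∑-𝟙 : ∀ {n} (A : Subset n) → ∑[ i < n ] 𝟙 A i ≡ + ∣ A ∣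
  ∑-𝟙 []             = refl
  ∑-𝟙 (inside ∷ A)  = cong (_+_ 1ℤ) (∑-𝟙 A)
  ∑-𝟙 (outside ∷ A) = trans (ℤ.+-identityˡ _) (∑-𝟙 A)

  select : ∀ {n} {P : Fin n → Set} → (∀ i → Dec (P i)) → Subset n
  select P? = tabulate λ i → if does (P? i) then inside else outside

  module _ {n} {P : Fin n → Set} (P? : ∀ i → Dec (P i)) where

    ∈-select⁻ : ∀ {i} → i ∈ select P? → P i
    ∈-select⁻ {i} i∈ with P? i | trans (sym (lookup∘tabulate _ i)) ([]=⇒lookup i∈)
    ... | yes Pi | _  = Pi
    ... | no _   | ()

    ∈-select⁺ : ∀ {i} → P i → i ∈ select P?
    ∈-select⁺ {i} Pi = lookup⇒[]= i (select P?) (trans (lookup∘tabulate _ i) (inside-if (P? i)))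
      where
      inside-if : (d : Dec (P i)) → (if does d then inside else outside) ≡ inside
      inside-if (yes _)  = refl
      inside-if (no ¬Pi) = ⊥-elim (¬Pi Pi)

    𝟙-select : ∀ i → 𝟙 (select P?) i ≡ 𝕀 (P? i)
    𝟙-select i with i ∈? select P? | P? i
    ... | yes _  | yes _  = refl
    ... | no _   | no _   = refl
    ... | yes i∈ | no ¬Pi = ⊥-elim (¬Pi (∈-select⁻ i∈))
    ... | no i∉  | yes Pi = ⊥-elim (i∉ (∈-select⁺ Pi))

  module _ {m n} {S : Fin m → Fin m → Set} (S? : ∀ a b → Dec (S a b))
           (ψ : Fin m → Fin m → Fin n × Fin n)
           (ψ-injective : ∀ {a b a' b'} → S a b → S a' b' → ψ a b ≡ ψ a' b' → a ≡ a' × b ≡ b') where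

    private
      Hit : Fin n → Fin n → Fin m → Fin m → Set
      Hit x y a b = S a b × proj₁ (ψ a b) ≡ x × proj₂ (ψ a b) ≡ y

      hit? : ∀ x y a b → Dec (Hit x y a b)
      hit? x y a b = S? a b ×-dec proj₁ (ψ a b) ≟ x ×-dec proj₂ (ψ a b) ≟ y

      hit : Fin n → Fin n → Fin m → Fin m → ℤ
      hit x y a b = 𝕀 (hit? x y a b)

      hit-unique : ∀ {x y a b a' b'} → 0ℤ < hit x y a b → 0ℤ < hit x y a' b' → a ≡ a' × b ≡ b'
      hit-unique {x} {y} {a} {b} {a'} {b'} h>0 h'>0 with 𝕀-pos (hit? x y a b) h>0 | 𝕀-pos (hit? x y a' b') h'>0
      ... | s , refl , refl | s' , e₁ , e₂ = ψ-injective s s' (cong₂ _,_ (sym e₁) (sym e₂))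

      hits≤1 : ∀ x y → ∑[ a < m ] ∑[ b < m ] hit x y a b ≤ 1ℤ
      hits≤1 x y = ∑-≤1 (λ a → ∑[ b < m ] hit x y a b) row≤1 λ a a' r>0 r'>0 →
        let (b , h>0) = ∑-pos⇒pos (hit x y a) r>0 ; (b' , h'>0) = ∑-pos⇒pos (hit x y a') r'>0
        in proj₁ (hit-unique h>0 h'>0)
        where
        row≤1 : ∀ a → ∑[ b < m ] hit x y a b ≤ 1ℤ
        row≤1 a = ∑-≤1 (hit x y a) (λ b → 𝕀-≤1 (hit? x y a b)) λ b b' h>0 h'>0 → proj₂ (hit-unique h>0 h'>0)

    ∑∑-injective-≤ : (h : Fin n → Fin n → ℤ) → (∀ x y → 0ℤ ≤ h x y) →
      ∑[ a < m ] ∑[ b < m ] (𝕀 (S? a b) * uncurry h (ψ a b)) ≤ ∑[ x < n ] ∑[ y < n ] h x y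
    ∑∑-injective-≤ h h≥0 = begin
      ∑[ a < m ] ∑[ b < m ] (𝕀 (S? a b) * uncurry h (ψ a b))
        ≡⟨ sum-cong-≗ (λ a → sum-cong-≗ λ b → cong (𝕀 (S? a b) *_) (sym (∑∑-δ (ψ a b)))) ⟩
      ∑[ a < m ] ∑[ b < m ] (𝕀 (S? a b) * ∑[ x < n ] ∑[ y < n ] (δ (proj₁ (ψ a b)) x * (δ (proj₂ (ψ a b)) y * h x y)))
        ≡⟨ sum-cong-≗ (λ a → sum-cong-≗ λ b →
             *-distribˡ-∑∑ (𝕀 (S? a b)) λ x y → δ (proj₁ (ψ a b)) x * (δ (proj₂ (ψ a b)) y * h x y)) ⟩
      ∑[ a < m ] ∑[ b < m ] ∑[ x < n ] ∑[ y < n ] (𝕀 (S? a b) * (δ (proj₁ (ψ a b)) x * (δ (proj₂ (ψ a b)) y * h x y)))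
        ≡⟨ ∑∑-comm (λ a b x y → 𝕀 (S? a b) * (δ (proj₁ (ψ a b)) x * (δ (proj₂ (ψ a b)) y * h x y))) ⟩
      ∑[ x < n ] ∑[ y < n ] ∑[ a < m ] ∑[ b < m ] (𝕀 (S? a b) * (δ (proj₁ (ψ a b)) x * (δ (proj₂ (ψ a b)) y * h x y)))
        ≡⟨ sum-cong-≗ (λ x → sum-cong-≗ λ y → sum-cong-≗ λ a → sum-cong-≗ λ b → hit-term x y a b) ⟩
      ∑[ x < n ] ∑[ y < n ] ∑[ a < m ] ∑[ b < m ] (h x y * hit x y a b)
        ≡⟨ sum-cong-≗ (λ x → sum-cong-≗ λ y → sym (*-distribˡ-∑∑ (h x y) (hit x y))) ⟩
      ∑[ x < n ] ∑[ y < n ] (h x y * ∑[ a < m ] ∑[ b < m ] hit x y a b)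
        ≤⟨ ∑-mono-≤ (λ x → ∑-mono-≤ λ y → h·hits≤h x y) ⟩
      ∑[ x < n ] ∑[ y < n ] h x y ∎
      where
      open ℤ.≤-Reasoning
      ∑∑-δ : ∀ q → ∑[ x < n ] ∑[ y < n ] (δ (proj₁ q) x * (δ (proj₂ q) y * h x y)) ≡ uncurry h q
      ∑∑-δ (x₀ , y₀) = begin-equality
        ∑[ x < n ] ∑[ y < n ] (δ x₀ x * (δ y₀ y * h x y)) ≡⟨ sum-cong-≗ (λ x → sym (*-distribˡ-sum (δ x₀ x) λ y → δ y₀ y * h x y)) ⟩
        ∑[ x < n ] (δ x₀ x * ∑[ y < n ] (δ y₀ y * h x y))  ≡⟨ sum-cong-≗ (λ x → cong (δ x₀ x *_) (∑-δ y₀ (h x))) ⟩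
        ∑[ x < n ] (δ x₀ x * h x y₀)                       ≡⟨ ∑-δ x₀ (λ x → h x y₀) ⟩
        h x₀ y₀ ∎
      regroup : ∀ s d e k → s * (d * (e * k)) ≡ k * (s * (d * e))
      regroup = solve-∀
      hit-term : ∀ x y a b → 𝕀 (S? a b) * (δ (proj₁ (ψ a b)) x * (δ (proj₂ (ψ a b)) y * h x y)) ≡ h x y * hit x y a b
      hit-term x y a b = trans (regroup (𝕀 (S? a b)) (δ (proj₁ (ψ a b)) x) (δ (proj₂ (ψ a b)) y) (h x y))
        (cong (h x y *_) (sym (trans (𝕀-× (S? a b) (proj₁ (ψ a b) ≟ x ×-dec proj₂ (ψ a b) ≟ y))
                                     (cong (𝕀 (S? a b) *_) (𝕀-× (proj₁ (ψ a b) ≟ x) (proj₂ (ψ a b) ≟ y))))))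
      h·hits≤h : ∀ x y → h x y * ∑[ a < m ] ∑[ b < m ] hit x y a b ≤ h x y
      h·hits≤h x y = ℤ.≤-trans (ℤ.*-monoˡ-≤-nonNeg (h x y) {{nonNegative (h≥0 x y)}} (hits≤1 x y))
                               (ℤ.≤-reflexive (ℤ.*-identityʳ (h x y)))

  -- Cauchy–Schwarz

  record PositiveLinearFunctional (I : Set) : Set where
    field
      ∫        : (I → ℤ) → ℤ
      ∫-cong   : ∀ {f g} → (∀ i → f i ≡ g i) → ∫ f ≡ ∫ g
      ∫-+      : ∀ f g → ∫ (λ i → f i + g i) ≡ ∫ f + ∫ g
      ∫-*      : ∀ c f → ∫ (λ i → c * f i) ≡ c * ∫ f
      ∫-nonneg : ∀ f → (∀ i → 0ℤ ≤ f i) → 0ℤ ≤ ∫ f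

  ∑-functional : ∀ n → PositiveLinearFunctional (Fin n)
  ∑-functional n = record
    { ∫        = sum
    ; ∫-cong   = sum-cong-≗
    ; ∫-+      = ∑-distrib-+
    ; ∫-*      = λ c f → sym (*-distribˡ-sum c f)
    ; ∫-nonneg = λ f → ∑-nonneg
    }

  ∑∑-functional : ∀ m n → PositiveLinearFunctional (Fin m × Fin n)
  ∑∑-functional m n = record
    { ∫        = λ f → ∑[ i < m ] ∑[ j < n ] f (i , j)
    ; ∫-cong   = λ f≗g → sum-cong-≗ λ i → sum-cong-≗ λ j → f≗g (i , j)
    ; ∫-+      = λ f g → trans (sum-cong-≗ λ i → ∑-distrib-+ (λ j → f (i , j)) (λ j → g (i , j)))
                               (∑-distrib-+ (λ i → ∑[ j < n ] f (i , j)) (λ i → ∑[ j < n ] g (i , j)))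
    ; ∫-*      = λ c f → sym (*-distribˡ-∑∑ c λ i j → f (i , j))
    ; ∫-nonneg = λ f f≥0 → ∑-nonneg λ i → ∑-nonneg λ j → f≥0 (i , j)
    }

  module _ {I : Set} (L : PositiveLinearFunctional I) where
    open PositiveLinearFunctional L

    private
      factor-nonneg : ∀ {a x} → 0ℤ < a → 0ℤ ≤ a * x → 0ℤ ≤ x
      factor-nonneg {+0}       (+<+ ())
      factor-nonneg {+[1+ k ]} {x} _ 0≤ax = ℤ.*-cancelˡ-≤-pos 0ℤ x +[1+ k ] (subst (_≤ +[1+ k ] * x) (sym (ℤ.*-zeroʳ +[1+ k ])) 0≤ax)

      expand : ∀ t u x y → (t * x - u * y) * (t * x - u * y) ≡ t * t * (x * x) + (- (+ 2 * t * u) * (x * y) + u * u * (y * y))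
      expand = solve-∀

    cauchy-schwarz : ∀ (f g : I → ℤ) →
      ∫ (λ i → f i * g i) * ∫ (λ i → f i * g i) ≤ ∫ (λ i → f i * f i) * ∫ (λ i → g i * g i)
    cauchy-schwarz f g = by-cases (0ℤ ℤ.<? A) (0ℤ ℤ.<? B)
      where
      A B C : ℤ
      A = ∫ (λ i → f i * f i)
      B = ∫ (λ i → g i * g i)
      C = ∫ (λ i → f i * g i)

      quadratic : ∀ t u → 0ℤ ≤ t * t * A + (- (+ 2 * t * u) * C + u * u * B)
      quadratic t u = begin
        0ℤ ≤⟨ ∫-nonneg _ (λ i → square-nonneg (t * f i - u * g i)) ⟩
        ∫ (λ i → (t * f i - u * g i) * (t * f i - u * g i))
          ≡⟨ ∫-cong (λ i → expand t u (f i) (g i)) ⟩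
        ∫ (λ i → t * t * (f i * f i) + (- (+ 2 * t * u) * (f i * g i) + u * u * (g i * g i)))
          ≡⟨ ∫-+ (λ i → t * t * (f i * f i)) _ ⟩
        ∫ (λ i → t * t * (f i * f i)) + ∫ (λ i → - (+ 2 * t * u) * (f i * g i) + u * u * (g i * g i))
          ≡⟨ cong (_+_ (∫ (λ i → t * t * (f i * f i)))) (∫-+ (λ i → - (+ 2 * t * u) * (f i * g i)) _) ⟩
        ∫ (λ i → t * t * (f i * f i)) + (∫ (λ i → - (+ 2 * t * u) * (f i * g i)) + ∫ (λ i → u * u * (g i * g i)))
          ≡⟨ cong₂ _+_ (∫-* (t * t) _) (cong₂ _+_ (∫-* (- (+ 2 * t * u)) _) (∫-* (u * u) _)) ⟩
        t * t * A + (- (+ 2 * t * u) * C + u * u * B) ∎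
        where open ℤ.≤-Reasoning

      -- The nonnegative form t²A − 2tuC + u²B takes the values A (AB − C²) at (C , A) and B (AB − C²) at (B , C).
      at-CA : ∀ A B C → C * C * A + (- (+ 2 * C * A) * C + A * A * B) ≡ A * (A * B - C * C)
      at-CA = solve-∀
      at-BC : ∀ A B C → B * B * A + (- (+ 2 * B * C) * C + C * C * B) ≡ B * (A * B - C * C)
      at-BC = solve-∀
      at-C1 : ∀ C → C * C * 0ℤ + (- (+ 2 * C * 1ℤ) * C + 1ℤ * 1ℤ * 0ℤ) ≡ - (C * C + C * C)
      at-C1 = solve-∀

      by-cases : Dec (0ℤ < A) → Dec (0ℤ < B) → C * C ≤ A * B
      by-cases (yes A>0) _         = ℤ.0≤i-j⇒j≤i (factor-nonneg A>0 (subst (0ℤ ≤_) (at-CA A B C) (quadratic C A)))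
      by-cases (no _)    (yes B>0) = ℤ.0≤i-j⇒j≤i (factor-nonneg B>0 (subst (0ℤ ≤_) (at-BC A B C) (quadratic B C)))
      by-cases (no A≯0)  (no B≯0)  = begin
        C * C          ≤⟨ ℤ.i≤i+j (C * C) (C * C) {{nonNegative (square-nonneg C)}} ⟩
        C * C + C * C  ≤⟨ ℤ.neg-cancel-≤ (subst (0ℤ ≤_) (at-C1 C)
                            (subst₂ (λ a b → 0ℤ ≤ C * C * a + (- (+ 2 * C * 1ℤ) * C + 1ℤ * 1ℤ * b)) A≡0 B≡0 (quadratic C 1ℤ))) ⟩
        0ℤ             ≡⟨ cong (_* B) A≡0 ⟨
        A * B          ∎
        where
        open ℤ.≤-Reasoning
        A≡0 : A ≡ 0ℤ
        A≡0 = ℤ.≤-antisym (ℤ.≮⇒≥ A≯0) (∫-nonneg _ λ i → square-nonneg (f i))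
        B≡0 : B ≡ 0ℤ
        B≡0 = ℤ.≤-antisym (ℤ.≮⇒≥ B≯0) (∫-nonneg _ λ i → square-nonneg (g i))

  -- Arithmetic modulo p

  module ZMod (p : ℕ) (p-prime : Prime p) where

    instance
      p≢0 : NonZero p
      p≢0 = prime⇒nonZero p-prime

    -- Congruence modulo p on ℤ, a record so that x and y can be read off a proof; residues are
    -- Fin p, embedded by ⟦_⟧ and reduced by [_].
    infix 4 _≈_ _≉_
    record _≈_ (x y : ℤ) : Set where
      constructor mod-p
      field p∣x-y : + p ∣ x - y
    open _≈_ public

    _≉_ : ℤ → ℤ → Set
    x ≉ y = ¬ x ≈ y

    ≡⇒≈ : ∀ {x y} → x ≡ y → x ≈ y
    ≡⇒≈ {x} refl = mod-p (divides 0ℤ (ℤ.+-inverseʳ x))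

    ≈-sym : ∀ {x y} → x ≈ y → y ≈ x
    ≈-sym {x} {y} (mod-p d) = mod-p (subst (+ p ∣_) (lemma x y) (∣m⇒∣-m d))
      where lemma : ∀ x y → - (x - y) ≡ y - x
            lemma = solve-∀

    ≈-trans : ∀ {x y z} → x ≈ y → y ≈ z → x ≈ z
    ≈-trans {x} {y} {z} (mod-p d) (mod-p e) = mod-p (subst (+ p ∣_) (lemma x y z) (∣m∣n⇒∣m+n d e))
      where lemma : ∀ x y z → x - y + (y - z) ≡ x - z
            lemma = solve-∀

    ≈-setoid : Setoid 0ℓ 0ℓ
    ≈-setoid = record
      { Carrier = ℤ ; _≈_ = _≈_
      ; isEquivalence = record { refl = ≡⇒≈ refl ; sym = ≈-sym ; trans = ≈-trans } }

    module ≈-Reasoning = SetoidReasoning ≈-setoid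

    +-cong : ∀ {x y u v} → x ≈ y → u ≈ v → x + u ≈ y + v
    +-cong {x} {y} {u} {v} (mod-p d) (mod-p e) = mod-p (subst (+ p ∣_) (lemma x y u v) (∣m∣n⇒∣m+n d e))
      where lemma : ∀ x y u v → x - y + (u - v) ≡ x + u - (y + v)
            lemma = solve-∀

    *-cong : ∀ {x y u v} → x ≈ y → u ≈ v → x * u ≈ y * v
    *-cong {x} {y} {u} {v} (mod-p d) (mod-p e) =
      mod-p (subst (+ p ∣_) (lemma x y u v) (∣m∣n⇒∣m+n (∣m⇒∣m*n u d) (∣n⇒∣m*n y e)))
      where lemma : ∀ x y u v → (x - y) * u + y * (u - v) ≡ x * u - y * v
            lemma = solve-∀

    +-congˡ : ∀ x {u v} → u ≈ v → x + u ≈ x + v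
    +-congˡ x = +-cong (≡⇒≈ {x} refl)

    +-congʳ : ∀ u {x y} → x ≈ y → x + u ≈ y + u
    +-congʳ u x≈y = +-cong x≈y (≡⇒≈ {u} refl)

    *-congˡ : ∀ x {u v} → u ≈ v → x * u ≈ x * v
    *-congˡ x = *-cong (≡⇒≈ {x} refl)

    *-congʳ : ∀ u {x y} → x ≈ y → x * u ≈ y * u
    *-congʳ u x≈y = *-cong x≈y (≡⇒≈ {u} refl)

    -‿cong : ∀ {x y} → x ≈ y → - x ≈ - y
    -‿cong {x} {y} (mod-p d) = mod-p (subst (+ p ∣_) (lemma x y) (∣m⇒∣-m d))
      where lemma : ∀ x y → - (x - y) ≡ - x - - y
            lemma = solve-∀

    ≈0⇒∣ : ∀ {x} → x ≈ 0ℤ → + p ∣ x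
    ≈0⇒∣ {x} (mod-p d) = subst (+ p ∣_) (ℤ.+-identityʳ x) d

    ∣⇒≈0 : ∀ {x} → + p ∣ x → x ≈ 0ℤ
    ∣⇒≈0 {x} d = mod-p (subst (+ p ∣_) (sym (ℤ.+-identityʳ x)) d)

    ≈⇒diff≈0 : ∀ {x y} → x ≈ y → x - y ≈ 0ℤ
    ≈⇒diff≈0 (mod-p d) = ∣⇒≈0 d

    diff≈0⇒≈ : ∀ {x y} → x - y ≈ 0ℤ → x ≈ y
    diff≈0⇒≈ d = mod-p (≈0⇒∣ d)

    zero-divisor : ∀ x y → x * y ≈ 0ℤ → x ≈ 0ℤ ⊎ y ≈ 0ℤ
    zero-divisor x y xy≈0 = ⊎-map (∣⇒≈0 ∘ ∣ᵤ⇒∣) (∣⇒≈0 ∘ ∣ᵤ⇒∣)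
      (euclidsLemma ∣ x ∣ᶻ ∣ y ∣ᶻ p-prime (subst (p ℕ∣.∣_) (ℤ.abs-* x y) (∣⇒∣ᵤ (≈0⇒∣ xy≈0))))

    *-cancelʳ-≈ : ∀ {x y z} → z ≉ 0ℤ → x * z ≈ y * z → x ≈ y
    *-cancelʳ-≈ {x} {y} {z} z≉0 xz≈yz =
      diff≈0⇒≈ (fromInj₁ (flip contradiction z≉0)
                          (zero-divisor (x - y) z (≈-trans (≡⇒≈ (lemma x y z)) (≈⇒diff≈0 xz≈yz))))
      where lemma : ∀ x y z → (x - y) * z ≡ x * z - y * z
            lemma = solve-∀

    ⟦_⟧ : Fin p → ℤ
    ⟦ a ⟧ = + toℕ a

    -- Opaque, so that unification never runs the division algorithm on symbolic integers.
    opaque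
      [_] : ℤ → Fin p
      [ x ] = fromℕ< (n%ℕd<d x p)

      ⟦[_]⟧ : ∀ x → ⟦ [ x ] ⟧ ≈ x
      ⟦[ x ]⟧ = mod-p (divides (- (x /ℕ p)) (begin
        ⟦ [ x ] ⟧ - x                           ≡⟨ cong (λ r → + r - x) (toℕ-fromℕ< (n%ℕd<d x p)) ⟩
        + (x %ℕ p) - x                          ≡⟨ cong (λ y → + (x %ℕ p) - y) (a≡a%ℕn+[a/ℕn]*n x p) ⟩
        + (x %ℕ p) - (+ (x %ℕ p) + x /ℕ p * + p) ≡⟨ lemma (+ (x %ℕ p)) (x /ℕ p) (+ p) ⟩
        - (x /ℕ p) * + p                        ∎))
        where
        open ≡-Reasoning
        lemma : ∀ r q n → r - (r + q * n) ≡ - q * n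
        lemma = solve-∀

    private
      ∣∧<⇒≡0 : ∀ {k} → p ℕ∣.∣ k → k ℕ.< p → k ≡ 0
      ∣∧<⇒≡0 {zero}  _   _   = refl
      ∣∧<⇒≡0 {suc k} p∣k k<p = contradiction p∣k (>⇒∤ k<p)

      residue-≤ : ∀ {m n} → n ℕ.< p → + m ≈ + n → m ℕ.≤ n → n ℕ.≤ m
      residue-≤ {m} {n} n<p (mod-p d) m≤n = ℕ.m∸n≡0⇒m≤n (∣∧<⇒≡0 p∣n-m (ℕ.≤-<-trans (ℕ.m∸n≤m n m) n<p))
        where
        p∣n-m : p ℕ∣.∣ n ∸ m
        p∣n-m = subst (p ℕ∣.∣_) (trans (cong ∣_∣ᶻ (trans (ℤ.m-n≡m⊖n m n) (ℤ.⊖-≤ m≤n))) (ℤ.∣-i∣≡∣i∣ (+ (n ∸ m))))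
                      (∣⇒∣ᵤ d)

    residue-injective : ∀ {m n} → m ℕ.< p → n ℕ.< p → + m ≈ + n → m ≡ n
    residue-injective {m} {n} m<p n<p m≈n with ℕ.≤-total m n
    ... | inj₁ m≤n = ℕ.≤-antisym m≤n (residue-≤ n<p m≈n m≤n)
    ... | inj₂ n≤m = ℕ.≤-antisym (residue-≤ m<p (≈-sym m≈n) n≤m) n≤m

    ⟦⟧-injective : ∀ {a b} → ⟦ a ⟧ ≈ ⟦ b ⟧ → a ≡ b
    ⟦⟧-injective {a} {b} a≈b = toℕ-injective (residue-injective (toℕ<n a) (toℕ<n b) a≈b)

    []-cong : ∀ {x y} → x ≈ y → [ x ] ≡ [ y ]
    []-cong {x} {y} x≈y = ⟦⟧-injective (≈-trans ⟦[ x ]⟧ (≈-trans x≈y (≈-sym ⟦[ y ]⟧)))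

    [⟦_⟧] : ∀ a → [ ⟦ a ⟧ ] ≡ a
    [⟦ a ⟧] = ⟦⟧-injective ⟦[ ⟦ a ⟧ ]⟧

    []-injective : ∀ {x y} → [ x ] ≡ [ y ] → x ≈ y
    []-injective {x} {y} eq = ≈-trans (≈-sym ⟦[ x ]⟧) (≈-trans (≡⇒≈ (cong ⟦_⟧ eq)) ⟦[ y ]⟧)

    record Invertible (x : ℤ) : Set where
      constructor invertible
      field
        x⁻¹   : ℤ
        x*x⁻¹ : x * x⁻¹ ≈ 1ℤ

    1-invertible : Invertible 1ℤ
    1-invertible = invertible 1ℤ (≡⇒≈ refl)

    ≉0⇒invertible : ∀ {x} → x ≉ 0ℤ → Invertible x
    ≉0⇒invertible {x} x≉0 = let (y , ny≈1) = residue-inverse in invertible y (≈-trans (*-congʳ y (≈-sym ⟦[ x ]⟧)) ny≈1)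
      where
      n : ℕ
      n = toℕ [ x ]
      instance
        n≢0 : NonZero n
        n≢0 = ℕ.≢-nonZero λ n≡0 → x≉0 (≈-trans (≈-sym ⟦[ x ]⟧) (≡⇒≈ (cong +_ n≡0)))
      residue-inverse : ∃ λ y → + n * y ≈ 1ℤ
      residue-inverse with coprime-Bézout (prime⇒coprime p-prime (toℕ<n [ x ]))
      ... | Bézout.+- r s 1+sn≡rp = - + s , diff≈0⇒≈ (∣⇒≈0 (divides (- + r) (begin
        + n * - + s - 1ℤ       ≡⟨ lemma (+ n) (+ s) ⟩
        - (1ℤ + + s * + n)     ≡⟨ cong (λ t → - t) (trans (cong (_+_ 1ℤ) (sym (ℤ.pos-* s n))) (sym (ℤ.pos-+ 1 (s ℕ.* n)))) ⟩
        - + (1 ℕ.+ s ℕ.* n)    ≡⟨ cong (λ t → - + t) 1+sn≡rp ⟩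
        - + (r ℕ.* p)          ≡⟨ cong -_ (ℤ.pos-* r p) ⟩
        - (+ r * + p)          ≡⟨ ℤ.neg-distribˡ-* (+ r) (+ p) ⟩
        - + r * + p            ∎)))
        where
        open ≡-Reasoning
        lemma : ∀ n s → n * - s - 1ℤ ≡ - (1ℤ + s * n)
        lemma = solve-∀
      ... | Bézout.-+ r s 1+rp≡sn = + s , diff≈0⇒≈ (∣⇒≈0 (divides (+ r) (begin
        + n * + s - 1ℤ         ≡⟨ cong (_- 1ℤ) (trans (sym (ℤ.pos-* n s)) (cong +_ (ℕ.*-comm n s))) ⟩
        + (s ℕ.* n) - 1ℤ       ≡⟨ cong (λ t → + t - 1ℤ) 1+rp≡sn ⟨
        + (1 ℕ.+ r ℕ.* p) - 1ℤ ≡⟨ cong (_- 1ℤ) (trans (ℤ.pos-+ 1 (r ℕ.* p)) (cong (_+_ 1ℤ) (ℤ.pos-* r p))) ⟩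
        1ℤ + + r * + p - 1ℤ    ≡⟨ lemma (+ r * + p) ⟩
        + r * + p              ∎)))
        where
        open ≡-Reasoning
        lemma : ∀ t → 1ℤ + t - 1ℤ ≡ t
        lemma = solve-∀

    affine : ℤ → ℤ → Fin p → Fin p
    affine α β a = [ α * ⟦ a ⟧ + β ]

    private
      affine-inverse : ∀ α α' → α * α' ≈ 1ℤ → ∀ β a → affine α' (- (α' * β)) (affine α β a) ≡ a
      affine-inverse α α' αα'≈1 β a = trans ([]-cong (begin
        α' * ⟦ [ α * ⟦ a ⟧ + β ] ⟧ + - (α' * β) ≈⟨ +-congʳ (- (α' * β)) (*-congˡ α' ⟦[ α * ⟦ a ⟧ + β ]⟧) ⟩
        α' * (α * ⟦ a ⟧ + β) + - (α' * β)       ≡⟨ lemma α α' β ⟦ a ⟧ ⟩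
        α * α' * ⟦ a ⟧                          ≈⟨ *-congʳ ⟦ a ⟧ αα'≈1 ⟩
        1ℤ * ⟦ a ⟧                              ≡⟨ ℤ.*-identityˡ ⟦ a ⟧ ⟩
        ⟦ a ⟧                                   ∎)) [⟦ a ⟧]
        where
        open ≈-Reasoning
        lemma : ∀ α α' β x → α' * (α * x + β) + - (α' * β) ≡ α * α' * x
        lemma = solve-∀

    ∑-affine : ∀ {α} → Invertible α → ∀ β (h : Fin p → ℤ) → ∑[ a < p ] h (affine α β a) ≡ ∑[ a < p ] h a
    ∑-affine {α} (invertible α' αα'≈1) β h = sym (∑-permute h (permutation (affine α β) (affine α' β') to∘from from∘to))
      where
      β' : ℤ
      β' = - (α' * β)
      from∘to : ∀ a → affine α' β' (affine α β a) ≡ a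
      from∘to = affine-inverse α α' αα'≈1 β
      α'α≈1 : α' * α ≈ 1ℤ
      α'α≈1 = ≈-trans (≡⇒≈ (ℤ.*-comm α' α)) αα'≈1
      β≈ : - (α * β') ≈ β
      β≈ = ≈-trans (≡⇒≈ (lemma α α' β)) (≈-trans (*-congʳ β αα'≈1) (≡⇒≈ (ℤ.*-identityˡ β)))
        where lemma : ∀ α α' β → - (α * - (α' * β)) ≡ α * α' * β
              lemma = solve-∀
      to∘from : ∀ b → affine α β (affine α' β' b) ≡ b
      to∘from b = trans ([]-cong (+-congˡ (α * ⟦ affine α' β' b ⟧) (≈-sym β≈))) (affine-inverse α' α α'α≈1 β' b)

    _≈?_ : ∀ x y → Dec (x ≈ y)
    x ≈? y = map′ []-injective []-cong ([ x ] ≟ [ y ])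

    -- A junk value 0 at a ≈ 0.
    opaque
      _⁻¹ : Fin p → ℤ
      a ⁻¹ with ⟦ a ⟧ ≈? 0ℤ
      ... | yes _   = 0ℤ
      ... | no a≉0 = Invertible.x⁻¹ (≉0⇒invertible a≉0)

      ⁻¹-inverse : ∀ {a} → ⟦ a ⟧ ≉ 0ℤ → ⟦ a ⟧ * a ⁻¹ ≈ 1ℤ
      ⁻¹-inverse {a} a≉0 with ⟦ a ⟧ ≈? 0ℤ
      ... | yes a≈0  = contradiction a≈0 a≉0
      ... | no  a≉0' = Invertible.x*x⁻¹ (≉0⇒invertible a≉0')

    square-root-unique : ∀ {x y} → x * x ≈ y * y → x + y ≉ 0ℤ → x ≈ y
    square-root-unique {x} {y} x²≈y² x+y≉0 =
      diff≈0⇒≈ (fromInj₁ (flip contradiction x+y≉0)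
                          (zero-divisor (x - y) (x + y) (≈-trans (≡⇒≈ (lemma x y)) (≈⇒diff≈0 x²≈y²))))
      where lemma : ∀ x y → (x - y) * (x + y) ≡ x * x - y * y
            lemma = solve-∀

    ZeroSumFree : Subset p → Set
    ZeroSumFree W = ∀ {a a'} → a ∈ W → a' ∈ W → ⟦ a ⟧ + ⟦ a' ⟧ ≉ 0ℤ

    ≉0-between-multiples : ∀ k {n} → k ℕ.* p ℕ.< n → n ℕ.< suc k ℕ.* p → + n ≉ 0ℤ
    ≉0-between-multiples k {n} kp<n n<kp+p n≈0 = ℕ.<-irrefl (sym r≡0) (ℕ.m<n⇒0<n∸m kp<n)
      where
      r : ℕ
      r = n ∸ k ℕ.* p
      n≡kp+r : n ≡ k ℕ.* p ℕ.+ r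
      n≡kp+r = sym (ℕ.m+[n∸m]≡n (ℕ.<⇒≤ kp<n))
      r<p : r ℕ.< p
      r<p = ℕ.+-cancelˡ-< (k ℕ.* p) r p (subst (ℕ._< k ℕ.* p ℕ.+ p) n≡kp+r (subst (n ℕ.<_) (ℕ.+-comm p (k ℕ.* p)) n<kp+p))
      n≈r : + n ≈ + r
      n≈r = mod-p (divides (+ k) (begin
        + n - + r                   ≡⟨ cong (λ m → + m - + r) n≡kp+r ⟩
        + (k ℕ.* p ℕ.+ r) - + r     ≡⟨ cong (_- + r) (trans (ℤ.pos-+ (k ℕ.* p) r) (cong (_+ + r) (ℤ.pos-* k p))) ⟩
        + k * + p + + r - + r       ≡⟨ lemma (+ k * + p) (+ r) ⟩
        + k * + p                   ∎))
        where
        open ≡-Reasoning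
        lemma : ∀ x r → x + r - r ≡ x
        lemma = solve-∀
      r≡0 : r ≡ 0
      r≡0 = residue-injective r<p (ℕ.≤-trans (ℕ.s≤s ℕ.z≤n) r<p) (≈-trans (≈-sym n≈r) n≈0)

  -- Sums along lines

  module LineSums (p : ℕ) (p-prime : Prime p) (g : Fin p → ℤ) (∑g≡0 : ∑[ u < p ] g u ≡ 0ℤ) where
    open ZMod p p-prime

    ‖g‖² : ℤ
    ‖g‖² = ∑[ u < p ] (g u * g u)

    line : Fin p → Fin p → Fin p → Fin p
    line m c u = [ ⟦ m ⟧ * ⟦ u ⟧ + ⟦ c ⟧ ]

    L : Fin p → Fin p → ℤ
    L m c = ∑[ u < p ] (g u * g (line m c u))

    private
      Q : Fin p → Fin p → ℤ
      Q u u' = ∑[ m < p ] ∑[ c < p ] (g (line m c u) * g (line m c u'))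

      Q-diagonal : ∀ u → Q u u ≡ + p * ‖g‖²
      Q-diagonal u = trans (sum-cong-≗ translate) (∑-const p ‖g‖²)
        where
        translate : ∀ m → ∑[ c < p ] (g (line m c u) * g (line m c u)) ≡ ‖g‖²
        translate m = trans (sum-cong-≗ λ c → cong (λ v → g v * g v) ([]-cong (≡⇒≈ (lemma ⟦ m ⟧ ⟦ u ⟧ ⟦ c ⟧))))
                            (∑-affine 1-invertible (⟦ m ⟧ * ⟦ u ⟧) (λ v → g v * g v))
          where lemma : ∀ m u c → m * u + c ≡ 1ℤ * c + m * u
                lemma = solve-∀

      Q-off-diagonal : ∀ {u u'} → ¬ u ≡ u' → Q u u' ≡ 0ℤ
      Q-off-diagonal {u} {u'} u≢u' = begin
        ∑[ m < p ] ∑[ c < p ] (g (line m c u) * g (line m c u'))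
          ≡⟨ sum-cong-≗ shear ⟩
        ∑[ m < p ] ∑[ v < p ] (g v * g (affine D ⟦ v ⟧ m))
          ≡⟨ ∑-comm (λ m v → g v * g (affine D ⟦ v ⟧ m)) ⟩
        ∑[ v < p ] ∑[ m < p ] (g v * g (affine D ⟦ v ⟧ m))
          ≡⟨ sum-cong-≗ (λ v → trans (sym (*-distribˡ-sum (g v) λ m → g (affine D ⟦ v ⟧ m)))
                                     (cong (_*_ (g v)) (trans (∑-affine (≉0⇒invertible D≉0) ⟦ v ⟧ g) ∑g≡0))) ⟩
        ∑[ v < p ] (g v * 0ℤ)
          ≡⟨ trans (sum-cong-≗ λ v → ℤ.*-zeroʳ (g v)) (sum-replicate-zero p) ⟩
        0ℤ ∎
        where
        open ≡-Reasoning
        D : ℤ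
        D = ⟦ u' ⟧ - ⟦ u ⟧
        D≉0 : D ≉ 0ℤ
        D≉0 D≈0 = u≢u' (sym (⟦⟧-injective (diff≈0⇒≈ D≈0)))
        -- substitute c = v − m u
        shear : ∀ m → ∑[ c < p ] (g (line m c u) * g (line m c u')) ≡ ∑[ v < p ] (g v * g (affine D ⟦ v ⟧ m))
        shear m = begin
          ∑[ c < p ] (g (line m c u) * g (line m c u'))
            ≡⟨ ∑-affine 1-invertible β (λ c → g (line m c u) * g (line m c u')) ⟨
          ∑[ v < p ] (g (line m (affine 1ℤ β v) u) * g (line m (affine 1ℤ β v) u'))
            ≡⟨ sum-cong-≗ (λ v → cong₂ (λ x y → g x * g y)
                 (trans ([]-cong (≈-trans (line-shift u v) (≡⇒≈ (cancel ⟦ u ⟧ ⟦ m ⟧ ⟦ v ⟧)))) [⟦ v ⟧])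
                 ([]-cong (line-shift u' v))) ⟩
          ∑[ v < p ] (g v * g (affine D ⟦ v ⟧ m)) ∎
          where
          β : ℤ
          β = - (⟦ m ⟧ * ⟦ u ⟧)
          cancel : ∀ u m v → (u - u) * m + v ≡ v
          cancel = solve-∀
          line-shift : ∀ w v → ⟦ m ⟧ * ⟦ w ⟧ + ⟦ affine 1ℤ β v ⟧ ≈ (⟦ w ⟧ - ⟦ u ⟧) * ⟦ m ⟧ + ⟦ v ⟧
          line-shift w v = ≈-trans (+-congˡ (⟦ m ⟧ * ⟦ w ⟧) ⟦[ 1ℤ * ⟦ v ⟧ + β ]⟧) (≡⇒≈ (lemma ⟦ m ⟧ ⟦ u ⟧ ⟦ v ⟧ ⟦ w ⟧))
            where lemma : ∀ m u v w → m * w + (1ℤ * v + - (m * u)) ≡ (w - u) * m + v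
                  lemma = solve-∀

      Q≡δ : ∀ u u' → Q u u' ≡ δ u u' * (+ p * ‖g‖²)
      Q≡δ u u' with u ≟ u'
      ... | yes refl = trans (Q-diagonal u) (sym (ℤ.*-identityˡ (+ p * ‖g‖²)))
      ... | no u≢u'  = Q-off-diagonal u≢u'

    ∑∑L² : ∑[ m < p ] ∑[ c < p ] (L m c * L m c) ≡ + p * ‖g‖² * ‖g‖²
    ∑∑L² = begin
      ∑[ m < p ] ∑[ c < p ] (L m c * L m c)
        ≡⟨ sum-cong-≗ (λ m → sum-cong-≗ λ c → ∑*∑ (λ u → g u * g (line m c u)) (λ u' → g u' * g (line m c u'))) ⟩
      ∑[ m < p ] ∑[ c < p ] ∑[ u < p ] ∑[ u' < p ] (g u * g (line m c u) * (g u' * g (line m c u')))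
        ≡⟨ ∑∑-comm (λ m c u u' → g u * g (line m c u) * (g u' * g (line m c u'))) ⟩
      ∑[ u < p ] ∑[ u' < p ] ∑[ m < p ] ∑[ c < p ] (g u * g (line m c u) * (g u' * g (line m c u')))
        ≡⟨ sum-cong-≗ (λ u → sum-cong-≗ λ u' → trans (sum-cong-≗ λ m → sum-cong-≗ λ c → regroup (g u) (g (line m c u)) (g u') (g (line m c u')))
                                                       (sym (*-distribˡ-∑∑ (g u * g u') λ m c → g (line m c u) * g (line m c u')))) ⟩
      ∑[ u < p ] ∑[ u' < p ] (g u * g u' * Q u u')
        ≡⟨ sum-cong-≗ (λ u → trans (sum-cong-≗ λ u' → trans (cong (g u * g u' *_) (Q≡δ u u')) (move (g u) (g u') (δ u u') (+ p * ‖g‖²)))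
                                    (∑-δ u λ u' → g u * (+ p * ‖g‖²) * g u')) ⟩
      ∑[ u < p ] (g u * (+ p * ‖g‖²) * g u)
        ≡⟨ sum-cong-≗ (λ u → move' (g u) (+ p * ‖g‖²)) ⟩
      ∑[ u < p ] (+ p * ‖g‖² * (g u * g u))
        ≡⟨ *-distribˡ-sum (+ p * ‖g‖²) (λ u → g u * g u) ⟨
      + p * ‖g‖² * ‖g‖² ∎
      where
      open ≡-Reasoning
      regroup : ∀ a b c d → a * b * (c * d) ≡ a * c * (b * d)
      regroup = solve-∀
      move : ∀ a b d k → a * b * (d * k) ≡ d * (a * k * b)
      move = solve-∀
      move' : ∀ a k → a * k * a ≡ k * (a * a)
      move' = solve-∀

  -- The counting argument

  module Counting (p : ℕ) (p-prime : Prime p) (W A₂ A₃ : Subset p) where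
    open ZMod p p-prime

    K B C : ℕ
    K = ∣ W ∣
    B = ∣ A₂ ∣
    C = ∣ A₃ ∣

    g : Fin p → ℤ
    g u = + p * 𝟙 A₃ u - + C

    ∑g≡0 : ∑[ u < p ] g u ≡ 0ℤ
    ∑g≡0 = begin
      ∑[ u < p ] (+ p * 𝟙 A₃ u - + C)              ≡⟨ ∑-distrib-+ (λ u → + p * 𝟙 A₃ u) (λ _ → - + C) ⟩
      ∑[ u < p ] (+ p * 𝟙 A₃ u) + ∑[ u < p ] (- + C) ≡⟨ cong₂ _+_ (trans (sym (*-distribˡ-sum (+ p) (𝟙 A₃))) (cong (+ p *_) (∑-𝟙 A₃))) (∑-const p (- + C)) ⟩
      + p * + C + + p * - + C                      ≡⟨ lemma (+ p) (+ C) ⟩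
      0ℤ                                           ∎
      where
      open ≡-Reasoning
      lemma : ∀ a b → a * b + a * - b ≡ 0ℤ
      lemma = solve-∀

    open LineSums p p-prime g ∑g≡0 public

    ‖g‖²-nonneg : 0ℤ ≤ ‖g‖²
    ‖g‖²-nonneg = ∑-nonneg λ u → square-nonneg (g u)

    ‖g‖²-≤ : ‖g‖² ≤ + p * + p * + C
    ‖g‖²-≤ = begin
      ∑[ u < p ] (g u * g u)
        ≡⟨ sum-cong-≗ g²-linear ⟩
      ∑[ u < p ] ((+ p * + p - + 2 * + p * + C) * 𝟙 A₃ u + + C * + C)
        ≡⟨ ∑-distrib-+ (λ u → (+ p * + p - + 2 * + p * + C) * 𝟙 A₃ u) (λ _ → + C * + C) ⟩
      ∑[ u < p ] ((+ p * + p - + 2 * + p * + C) * 𝟙 A₃ u) + ∑[ u < p ] (+ C * + C)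
        ≡⟨ cong₂ _+_ (trans (sym (*-distribˡ-sum (+ p * + p - + 2 * + p * + C) (𝟙 A₃))) (cong ((+ p * + p - + 2 * + p * + C) *_) (∑-𝟙 A₃))) (∑-const p (+ C * + C)) ⟩
      (+ p * + p - + 2 * + p * + C) * + C + + p * (+ C * + C)
        ≡⟨ lemma (+ p) (+ C) ⟩
      + p * + p * + C - + p * (+ C * + C)
        ≤⟨ ℤ.i-j≤i (+ p * + p * + C) (+ p * (+ C * + C)) {{nonNegative pC²≥0}} ⟩
      + p * + p * + C ∎
      where
      open ℤ.≤-Reasoning
      g²-linear : ∀ u → g u * g u ≡ (+ p * + p - + 2 * + p * + C) * 𝟙 A₃ u + + C * + C
      g²-linear u with u ∈? A₃
      ... | yes _ = lemma₁ (+ p) (+ C)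
        where lemma₁ : ∀ p c → (p * 1ℤ - c) * (p * 1ℤ - c) ≡ (p * p - + 2 * p * c) * 1ℤ + c * c
              lemma₁ = solve-∀
      ... | no _  = lemma₀ (+ p) (+ C)
        where lemma₀ : ∀ p c → (p * 0ℤ - c) * (p * 0ℤ - c) ≡ (p * p - + 2 * p * c) * 0ℤ + c * c
              lemma₀ = solve-∀
      lemma : ∀ p c → (p * p - + 2 * p * c) * c + p * (c * c) ≡ p * p * c - p * (c * c)
      lemma = solve-∀
      pC²≥0 : 0ℤ ≤ + p * (+ C * + C)
      pC²≥0 = subst (0ℤ ≤_) (trans (ℤ.pos-* p (C ℕ.* C)) (cong (+ p *_) (ℤ.pos-* C C))) (+≤+ ℕ.z≤n)

    φ : Fin p → Fin p → Fin p
    φ a x = [ - (⟦ a ⟧ * ⟦ a ⟧ + ⟦ a ⟧ * ⟦ x ⟧) ]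

    φ-solves : ∀ a x → ⟦ a ⟧ * ⟦ a ⟧ + ⟦ a ⟧ * ⟦ x ⟧ + ⟦ φ a x ⟧ ≈ 0ℤ
    φ-solves a x = ≈-trans (+-congˡ (⟦ a ⟧ * ⟦ a ⟧ + ⟦ a ⟧ * ⟦ x ⟧) ⟦[ - (⟦ a ⟧ * ⟦ a ⟧ + ⟦ a ⟧ * ⟦ x ⟧) ]⟧)
                           (≡⇒≈ (ℤ.+-inverseʳ (⟦ a ⟧ * ⟦ a ⟧ + ⟦ a ⟧ * ⟦ x ⟧)))

    T : Fin p → ℤ
    T x = ∑[ a < p ] (𝟙 W a * g (φ a x))

    S : ℤ
    S = ∑[ x < p ] (𝟙 A₂ x * T x)

    M : Fin p → Fin p → ℤ
    M a b = ∑[ x < p ] (g (φ a x) * g (φ b x))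

    module _ (sum-free : ZeroSumFree W)
             (unsolvable : ∀ {a x u} → a ∈ W → x ∈ A₂ → u ∈ A₃ → ⟦ a ⟧ * ⟦ a ⟧ + ⟦ a ⟧ * ⟦ x ⟧ + ⟦ u ⟧ ≉ 0ℤ) where

      S≡ : S ≡ - (+ B * + K * + C)
      S≡ = begin
        ∑[ x < p ] (𝟙 A₂ x * ∑[ a < p ] (𝟙 W a * g (φ a x)))
          ≡⟨ sum-cong-≗ (λ x → trans (*-distribˡ-sum (𝟙 A₂ x) λ a → 𝟙 W a * g (φ a x)) (sum-cong-≗ λ a → outside-A₃ x a)) ⟩
        ∑[ x < p ] ∑[ a < p ] (𝟙 A₂ x * (𝟙 W a * - + C))
          ≡⟨ ∑*∑ (𝟙 A₂) (λ a → 𝟙 W a * - + C) ⟨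
        ∑[ x < p ] 𝟙 A₂ x * ∑[ a < p ] (𝟙 W a * - + C)
          ≡⟨ cong₂ _*_ (∑-𝟙 A₂) (trans (sym (*-distribʳ-sum (- + C) (𝟙 W))) (cong (_* - + C) (∑-𝟙 W))) ⟩
        + B * (+ K * - + C)
          ≡⟨ lemma (+ B) (+ K) (+ C) ⟩
        - (+ B * + K * + C) ∎
        where
        open ≡-Reasoning
        lemma : ∀ b k c → b * (k * - c) ≡ - (b * k * c)
        lemma = solve-∀
        outside-A₃ : ∀ x a → 𝟙 A₂ x * (𝟙 W a * g (φ a x)) ≡ 𝟙 A₂ x * (𝟙 W a * - + C)
        outside-A₃ x a with x ∈? A₂ | a ∈? W | φ a x ∈? A₃
        ... | yes x∈A₂ | yes a∈W | yes φ∈A₃ = contradiction (φ-solves a x) (unsolvable a∈W x∈A₂ φ∈A₃)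
        ... | yes _    | yes _   | no _     = cong (λ t → 1ℤ * (1ℤ * t)) (lemma₀ (+ p) (+ C))
          where lemma₀ : ∀ p c → p * 0ℤ - c ≡ - c
                lemma₀ = solve-∀
        ... | yes _    | no _    | _        = refl
        ... | no _     | _       | _        = refl

      W-nonzero : ∀ {a} → a ∈ W → ⟦ a ⟧ ≉ 0ℤ
      W-nonzero a∈W a≈0 = sum-free a∈W a∈W (+-cong a≈0 a≈0)

      M-diagonal : ∀ {a} → a ∈ W → M a a ≡ ‖g‖²
      M-diagonal {a} a∈W = trans (sum-cong-≗ λ x → cong (λ v → g v * g v) ([]-cong (≡⇒≈ (lemma ⟦ a ⟧ ⟦ x ⟧))))
                                 (∑-affine -a-invertible (- (⟦ a ⟧ * ⟦ a ⟧)) (λ v → g v * g v))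
        where
        lemma : ∀ a x → - (a * a + a * x) ≡ - a * x + - (a * a)
        lemma = solve-∀
        -a-invertible : Invertible (- ⟦ a ⟧)
        -a-invertible = invertible (- (a ⁻¹)) (≈-trans (≡⇒≈ (lemma' ⟦ a ⟧ (a ⁻¹))) (⁻¹-inverse (W-nonzero a∈W)))
          where lemma' : ∀ a b → - a * - b ≡ a * b
                lemma' = solve-∀

      Distinct : Fin p → Fin p → Set
      Distinct a b = a ∈ W × b ∈ W × ¬ a ≡ b

      distinct? : ∀ a b → Dec (Distinct a b)
      distinct? a b = a ∈? W ×-dec b ∈? W ×-dec ¬? (a ≟ b)

      E : ℤ
      E = ∑[ a < p ] ∑[ b < p ] (𝕀 (distinct? a b) * M a b)

      ∑T² : ∑[ x < p ] (T x * T x) ≡ + K * ‖g‖² + E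
      ∑T² = begin
        ∑[ x < p ] (T x * T x)
          ≡⟨ sum-cong-≗ (λ x → ∑*∑ (λ a → 𝟙 W a * g (φ a x)) (λ b → 𝟙 W b * g (φ b x))) ⟩
        ∑[ x < p ] ∑[ a < p ] ∑[ b < p ] (𝟙 W a * g (φ a x) * (𝟙 W b * g (φ b x)))
          ≡⟨ ∑-comm (λ x a → ∑[ b < p ] (𝟙 W a * g (φ a x) * (𝟙 W b * g (φ b x)))) ⟩
        ∑[ a < p ] ∑[ x < p ] ∑[ b < p ] (𝟙 W a * g (φ a x) * (𝟙 W b * g (φ b x)))
          ≡⟨ sum-cong-≗ (λ a → ∑-comm λ x b → 𝟙 W a * g (φ a x) * (𝟙 W b * g (φ b x))) ⟩
        ∑[ a < p ] ∑[ b < p ] ∑[ x < p ] (𝟙 W a * g (φ a x) * (𝟙 W b * g (φ b x)))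
          ≡⟨ sum-cong-≗ (λ a → sum-cong-≗ λ b → trans (sum-cong-≗ λ x → regroup (𝟙 W a) (g (φ a x)) (𝟙 W b) (g (φ b x)))
                                                    (sym (*-distribˡ-sum (𝟙 W a * 𝟙 W b) λ x → g (φ a x) * g (φ b x)))) ⟩
        ∑[ a < p ] ∑[ b < p ] (𝟙 W a * 𝟙 W b * M a b)
          ≡⟨ sum-cong-≗ (λ a → trans (sum-cong-≗ (split a)) (∑-distrib-+ (λ b → δ a b * (𝟙 W a * M a b)) λ b → 𝕀 (distinct? a b) * M a b)) ⟩
        ∑[ a < p ] (∑[ b < p ] (δ a b * (𝟙 W a * M a b)) + ∑[ b < p ] (𝕀 (distinct? a b) * M a b))
          ≡⟨ ∑-distrib-+ (λ a → ∑[ b < p ] (δ a b * (𝟙 W a * M a b))) (λ a → ∑[ b < p ] (𝕀 (distinct? a b) * M a b)) ⟩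
        ∑[ a < p ] ∑[ b < p ] (δ a b * (𝟙 W a * M a b)) + E
          ≡⟨ cong (_+ E) (trans (sum-cong-≗ λ a → trans (∑-δ a λ b → 𝟙 W a * M a b) (diagonal a))
                                (trans (sym (*-distribʳ-sum ‖g‖² (𝟙 W))) (cong (_* ‖g‖²) (∑-𝟙 W)))) ⟩
        + K * ‖g‖² + E ∎
        where
        open ≡-Reasoning
        regroup : ∀ a b c d → a * b * (c * d) ≡ a * c * (b * d)
        regroup = solve-∀
        same : ∀ m → 1ℤ * 1ℤ * m ≡ 1ℤ * (1ℤ * m) + 0ℤ
        same = solve-∀
        different : ∀ m → 1ℤ * 1ℤ * m ≡ 0ℤ + 1ℤ * m
        different = solve-∀
        split : ∀ a b → 𝟙 W a * 𝟙 W b * M a b ≡ δ a b * (𝟙 W a * M a b) + 𝕀 (a ∈? W ×-dec b ∈? W ×-dec ¬? (a ≟ b)) * M a b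
        split a b with a ∈? W | b ∈? W | a ≟ b
        ... | yes _   | yes _   | yes refl = same (M a a)
        ... | yes _   | yes _   | no _     = different (M a b)
        ... | yes a∈W | no a∉W  | yes refl = contradiction a∈W a∉W
        ... | yes _   | no _    | no _     = ℤ.*-zeroˡ (M a b)
        ... | no _    | _       | yes refl = refl
        ... | no _    | _       | no _     = refl
        diagonal : ∀ a → 𝟙 W a * M a a ≡ 𝟙 W a * ‖g‖²
        diagonal a with a ∈? W
        ... | yes a∈W = cong (1ℤ *_) (M-diagonal a∈W)
        ... | no _    = refl

      slope intercept : Fin p → Fin p → Fin p
      slope a b = [ ⟦ b ⟧ * a ⁻¹ ]
      intercept a b = [ ⟦ a ⟧ * ⟦ b ⟧ - ⟦ b ⟧ * ⟦ b ⟧ ]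

      σ : Fin p → Fin p → Fin p
      σ a = affine (- a ⁻¹) (- ⟦ a ⟧)

      σ-invertible : ∀ {a} → a ∈ W → Invertible (- a ⁻¹)
      σ-invertible {a} a∈W = invertible (- ⟦ a ⟧) (≈-trans (≡⇒≈ (lemma (a ⁻¹) ⟦ a ⟧)) (⁻¹-inverse (W-nonzero a∈W)))
        where lemma : ∀ i a → - i * - a ≡ a * i
              lemma = solve-∀

      φ∘σ-diagonal : ∀ {a} → a ∈ W → ∀ u → φ a (σ a u) ≡ u
      φ∘σ-diagonal {a} a∈W u = trans ([]-cong (begin
        - (⟦ a ⟧ * ⟦ a ⟧ + ⟦ a ⟧ * ⟦ σ a u ⟧)                  ≈⟨ -‿cong (+-congˡ (⟦ a ⟧ * ⟦ a ⟧) (*-congˡ ⟦ a ⟧ ⟦[ - a ⁻¹ * ⟦ u ⟧ + - ⟦ a ⟧ ]⟧)) ⟩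
        - (⟦ a ⟧ * ⟦ a ⟧ + ⟦ a ⟧ * (- a ⁻¹ * ⟦ u ⟧ + - ⟦ a ⟧)) ≡⟨ lemma ⟦ a ⟧ (a ⁻¹) ⟦ u ⟧ ⟩
        ⟦ a ⟧ * a ⁻¹ * ⟦ u ⟧                                  ≈⟨ *-congʳ ⟦ u ⟧ (⁻¹-inverse (W-nonzero a∈W)) ⟩
        1ℤ * ⟦ u ⟧                                            ≡⟨ ℤ.*-identityˡ ⟦ u ⟧ ⟩
        ⟦ u ⟧                                                 ∎)) [⟦ u ⟧]
        where
        open ≈-Reasoning
        lemma : ∀ a i u → - (a * a + a * (- i * u + - a)) ≡ a * i * u
        lemma = solve-∀

      φ∘σ-line : ∀ {a} → a ∈ W → ∀ b u → φ b (σ a u) ≡ line (slope a b) (intercept a b) u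
      φ∘σ-line {a} a∈W b u = []-cong (begin
        - (⟦ b ⟧ * ⟦ b ⟧ + ⟦ b ⟧ * ⟦ σ a u ⟧)                  ≈⟨ -‿cong (+-congˡ (⟦ b ⟧ * ⟦ b ⟧) (*-congˡ ⟦ b ⟧ ⟦[ - a ⁻¹ * ⟦ u ⟧ + - ⟦ a ⟧ ]⟧)) ⟩
        - (⟦ b ⟧ * ⟦ b ⟧ + ⟦ b ⟧ * (- a ⁻¹ * ⟦ u ⟧ + - ⟦ a ⟧)) ≡⟨ lemma ⟦ a ⟧ ⟦ b ⟧ (a ⁻¹) ⟦ u ⟧ ⟩
        ⟦ b ⟧ * a ⁻¹ * ⟦ u ⟧ + (⟦ a ⟧ * ⟦ b ⟧ - ⟦ b ⟧ * ⟦ b ⟧) ≈⟨ +-cong (*-congʳ ⟦ u ⟧ (≈-sym ⟦[ ⟦ b ⟧ * a ⁻¹ ]⟧))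
                                                                       (≈-sym ⟦[ ⟦ a ⟧ * ⟦ b ⟧ - ⟦ b ⟧ * ⟦ b ⟧ ]⟧) ⟩
        ⟦ slope a b ⟧ * ⟦ u ⟧ + ⟦ intercept a b ⟧              ∎)
        where
        open ≈-Reasoning
        lemma : ∀ a b i u → - (b * b + b * (- i * u + - a)) ≡ b * i * u + (a * b - b * b)
        lemma = solve-∀

      M≡L : ∀ {a} → a ∈ W → ∀ b → M a b ≡ L (slope a b) (intercept a b)
      M≡L {a} a∈W b = begin
        ∑[ x < p ] (g (φ a x) * g (φ b x))         ≡⟨ ∑-affine (σ-invertible a∈W) (- ⟦ a ⟧) (λ x → g (φ a x) * g (φ b x)) ⟨
        ∑[ u < p ] (g (φ a (σ a u)) * g (φ b (σ a u))) ≡⟨ sum-cong-≗ (λ u → cong₂ (λ v w → g v * g w) (φ∘σ-diagonal a∈W u) (φ∘σ-line a∈W b u)) ⟩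
        ∑[ u < p ] (g u * g (line (slope a b) (intercept a b) u)) ∎
        where open ≡-Reasoning

      slope-spec : ∀ {a} → a ∈ W → ∀ b → ⟦ b ⟧ ≈ ⟦ slope a b ⟧ * ⟦ a ⟧
      slope-spec {a} a∈W b = begin
        ⟦ b ⟧                        ≡⟨ ℤ.*-identityʳ ⟦ b ⟧ ⟨
        ⟦ b ⟧ * 1ℤ                   ≈⟨ *-congˡ ⟦ b ⟧ (⁻¹-inverse (W-nonzero a∈W)) ⟨
        ⟦ b ⟧ * (⟦ a ⟧ * a ⁻¹)       ≡⟨ lemma ⟦ a ⟧ ⟦ b ⟧ (a ⁻¹) ⟩
        ⟦ b ⟧ * a ⁻¹ * ⟦ a ⟧         ≈⟨ *-congʳ ⟦ a ⟧ ⟦[ ⟦ b ⟧ * a ⁻¹ ]⟧ ⟨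
        ⟦ slope a b ⟧ * ⟦ a ⟧        ∎
        where
        open ≈-Reasoning
        lemma : ∀ a b i → b * (a * i) ≡ b * i * a
        lemma = solve-∀

      intercept-spec : ∀ a b m → ⟦ b ⟧ ≈ m * ⟦ a ⟧ → ⟦ intercept a b ⟧ ≈ (m - m * m) * (⟦ a ⟧ * ⟦ a ⟧)
      intercept-spec a b m b≈ma = begin
        ⟦ intercept a b ⟧                                   ≈⟨ ⟦[ ⟦ a ⟧ * ⟦ b ⟧ - ⟦ b ⟧ * ⟦ b ⟧ ]⟧ ⟩
        ⟦ a ⟧ * ⟦ b ⟧ - ⟦ b ⟧ * ⟦ b ⟧                       ≈⟨ +-cong (*-congˡ ⟦ a ⟧ b≈ma) (-‿cong (*-cong b≈ma b≈ma)) ⟩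
        ⟦ a ⟧ * (m * ⟦ a ⟧) - m * ⟦ a ⟧ * (m * ⟦ a ⟧)       ≡⟨ lemma ⟦ a ⟧ m ⟩
        (m - m * m) * (⟦ a ⟧ * ⟦ a ⟧)                       ∎
        where
        open ≈-Reasoning
        lemma : ∀ a m → a * (m * a) - m * a * (m * a) ≡ (m - m * m) * (a * a)
        lemma = solve-∀

      -- The line through (a , b) determines m = b/a, hence (m − m²) a², hence a up to sign.
      chord-injective : ∀ {a b a' b'} → Distinct a b → Distinct a' b' →
                        (slope a b , intercept a b) ≡ (slope a' b' , intercept a' b') → a ≡ a' × b ≡ b'
      chord-injective {a} {b} {a'} {b'} (a∈W , b∈W , a≢b) (a'∈W , b'∈W , _) same-chord = a≡a' , b≡b'
        where
        m : ℤ
        m = ⟦ slope a b ⟧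
        b≈ma : ⟦ b ⟧ ≈ m * ⟦ a ⟧
        b≈ma = slope-spec a∈W b
        b'≈ma' : ⟦ b' ⟧ ≈ m * ⟦ a' ⟧
        b'≈ma' = ≈-trans (slope-spec a'∈W b') (≡⇒≈ (cong (λ s → ⟦ s ⟧ * ⟦ a' ⟧) (sym (cong proj₁ same-chord))))
        k : ℤ
        k = m - m * m
        a²k≈a'²k : ⟦ a ⟧ * ⟦ a ⟧ * k ≈ ⟦ a' ⟧ * ⟦ a' ⟧ * k
        a²k≈a'²k = begin
          ⟦ a ⟧ * ⟦ a ⟧ * k        ≡⟨ ℤ.*-comm (⟦ a ⟧ * ⟦ a ⟧) k ⟩
          k * (⟦ a ⟧ * ⟦ a ⟧)      ≈⟨ intercept-spec a b m b≈ma ⟨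
          ⟦ intercept a b ⟧        ≡⟨ cong (λ c → ⟦ proj₂ c ⟧) same-chord ⟩
          ⟦ intercept a' b' ⟧      ≈⟨ intercept-spec a' b' m b'≈ma' ⟩
          k * (⟦ a' ⟧ * ⟦ a' ⟧)    ≡⟨ ℤ.*-comm k (⟦ a' ⟧ * ⟦ a' ⟧) ⟩
          ⟦ a' ⟧ * ⟦ a' ⟧ * k      ∎
          where open ≈-Reasoning
        k≉0 : k ≉ 0ℤ
        k≉0 k≈0 = contradiction (zero-divisor m (1ℤ - m) (≈-trans (≡⇒≈ (lemma m)) k≈0)) neither
          where
          lemma : ∀ m → m * (1ℤ - m) ≡ m - m * m
          lemma = solve-∀
          neither : ¬ (m ≈ 0ℤ ⊎ 1ℤ - m ≈ 0ℤ)
          neither (inj₁ m≈0)   = W-nonzero b∈W (≈-trans b≈ma (*-congʳ ⟦ a ⟧ m≈0))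
          neither (inj₂ 1-m≈0) = a≢b (⟦⟧-injective (≈-sym (≈-trans b≈ma
            (≈-trans (*-congʳ ⟦ a ⟧ (≈-sym (diff≈0⇒≈ {1ℤ} {m} 1-m≈0))) (≡⇒≈ (ℤ.*-identityˡ ⟦ a ⟧))))))
        a≡a' : a ≡ a'
        a≡a' = ⟦⟧-injective (square-root-unique {⟦ a ⟧} {⟦ a' ⟧}
          (*-cancelʳ-≈ {⟦ a ⟧ * ⟦ a ⟧} {⟦ a' ⟧ * ⟦ a' ⟧} {k} k≉0 a²k≈a'²k)
          (sum-free a∈W a'∈W))
        b≡b' : b ≡ b'
        b≡b' = ⟦⟧-injective (≈-trans b≈ma (≈-trans (≡⇒≈ (cong (λ c → m * ⟦ c ⟧) a≡a')) (≈-sym b'≈ma')))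

      cs₁ : S * S ≤ + B * ∑[ x < p ] (T x * T x)
      cs₁ = begin
        S * S                                                        ≡⟨ cong₂ _*_ masked masked ⟨
        ∑[ x < p ] (𝟙 A₂ x * (𝟙 A₂ x * T x)) * ∑[ x < p ] (𝟙 A₂ x * (𝟙 A₂ x * T x))
          ≤⟨ cauchy-schwarz (∑-functional p) (𝟙 A₂) (λ x → 𝟙 A₂ x * T x) ⟩
        ∑[ x < p ] (𝟙 A₂ x * 𝟙 A₂ x) * ∑[ x < p ] ((𝟙 A₂ x * T x) * (𝟙 A₂ x * T x))
          ≤⟨ ℤ.*-monoˡ-≤-nonNeg _ {{nonNegative (∑-nonneg λ x → square-nonneg (𝟙 A₂ x))}}
                                (∑-mono-≤ λ x → 𝕀-mask-square-≤ (x ∈? A₂) (T x)) ⟩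
        ∑[ x < p ] (𝟙 A₂ x * 𝟙 A₂ x) * ∑[ x < p ] (T x * T x)      ≡⟨ cong (_* ∑[ x < p ] (T x * T x)) (trans (sum-cong-≗ λ x → 𝕀-idem (x ∈? A₂)) (∑-𝟙 A₂)) ⟩
        + B * ∑[ x < p ] (T x * T x)                                ∎
        where
        open ℤ.≤-Reasoning
        masked : ∑[ x < p ] (𝟙 A₂ x * (𝟙 A₂ x * T x)) ≡ S
        masked = sum-cong-≗ λ x → 𝕀-absorb (x ∈? A₂) (T x)

      cs₂ : E * E ≤ + K * + K * (+ p * ‖g‖² * ‖g‖²)
      cs₂ = begin
        E * E                                  ≡⟨ cong₂ _*_ masked masked ⟨
        ∑[ a < p ] ∑[ b < p ] (v a b * (v a b * M a b)) * ∑[ a < p ] ∑[ b < p ] (v a b * (v a b * M a b))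
          ≤⟨ cauchy-schwarz (∑∑-functional p p) (λ (a , b) → v a b) (λ (a , b) → v a b * M a b) ⟩
        ∑[ a < p ] ∑[ b < p ] (v a b * v a b) * ∑[ a < p ] ∑[ b < p ] ((v a b * M a b) * (v a b * M a b))
          ≤⟨ ℤ.*-monoʳ-≤-nonNeg (∑[ a < p ] ∑[ b < p ] ((v a b * M a b) * (v a b * M a b)))
               {{nonNegative (∑-nonneg λ a → ∑-nonneg λ b → square-nonneg (v a b * M a b))}} weights≤ ⟩
        + K * + K * ∑[ a < p ] ∑[ b < p ] ((v a b * M a b) * (v a b * M a b))
          ≤⟨ ℤ.*-monoˡ-≤-nonNeg (+ K * + K) {{nonNegative (square-nonneg (+ K))}} chords≤ ⟩
        + K * + K * (+ p * ‖g‖² * ‖g‖²)        ∎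
        where
        open ℤ.≤-Reasoning
        v : Fin p → Fin p → ℤ
        v a b = 𝕀 (distinct? a b)
        weights≤ : ∑[ a < p ] ∑[ b < p ] (v a b * v a b) ≤ + K * + K
        weights≤ = begin
          ∑[ a < p ] ∑[ b < p ] (v a b * v a b)    ≤⟨ ∑-mono-≤ (λ a → ∑-mono-≤ λ b → v²≤ a b) ⟩
          ∑[ a < p ] ∑[ b < p ] (𝟙 W a * 𝟙 W b)   ≡⟨ ∑*∑ (𝟙 W) (𝟙 W) ⟨
          ∑[ a < p ] 𝟙 W a * ∑[ b < p ] 𝟙 W b     ≡⟨ cong₂ _*_ (∑-𝟙 W) (∑-𝟙 W) ⟩
          + K * + K                                ∎
          where
          v²≤ : ∀ a b → v a b * v a b ≤ 𝟙 W a * 𝟙 W b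
          v²≤ a b with a ∈? W | b ∈? W | a ≟ b
          ... | yes _ | yes _ | yes _ = +≤+ ℕ.z≤n
          ... | yes _ | yes _ | no _  = ℤ.≤-refl
          ... | yes _ | no _  | _     = ℤ.≤-refl
          ... | no _  | _     | _     = ℤ.≤-refl
        chords≤ : ∑[ a < p ] ∑[ b < p ] ((v a b * M a b) * (v a b * M a b)) ≤ + p * ‖g‖² * ‖g‖²
        chords≤ = begin
          ∑[ a < p ] ∑[ b < p ] ((v a b * M a b) * (v a b * M a b))
            ≡⟨ sum-cong-≗ (λ a → sum-cong-≗ λ b → trans (𝕀-mask-square (distinct? a b) (M a b)) (on-chord a b)) ⟩
          ∑[ a < p ] ∑[ b < p ] (v a b * uncurry (λ m c → L m c * L m c) (slope a b , intercept a b))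
            ≤⟨ ∑∑-injective-≤ distinct? (λ a b → slope a b , intercept a b) chord-injective
                 (λ m c → L m c * L m c) (λ m c → square-nonneg (L m c)) ⟩
          ∑[ m < p ] ∑[ c < p ] (L m c * L m c)
            ≡⟨ ∑∑L² ⟩
          + p * ‖g‖² * ‖g‖² ∎
          where
          on-chord : ∀ a b → v a b * (M a b * M a b) ≡ v a b * (L (slope a b) (intercept a b) * L (slope a b) (intercept a b))
          on-chord a b = 𝕀-*-cong (distinct? a b) λ (a∈W , _) → cong (λ t → t * t) (M≡L a∈W b)
        masked : ∑[ a < p ] ∑[ b < p ] (v a b * (v a b * M a b)) ≡ E
        masked = sum-cong-≗ λ a → sum-cong-≗ λ b → 𝕀-absorb (distinct? a b) (M a b)

  -- Halving a set of residues

  module Halves (p : ℕ) (p-prime : Prime p) (p-odd : ∀ (a : Fin p) → 2 ℕ.* toℕ a ≢ p) (A : Subset p) where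
    open ZMod p p-prime

    Lower Upper : Fin p → Set
    Lower a = a ∈ A × 0 ℕ.< toℕ a × 2 ℕ.* toℕ a ℕ.< p
    Upper a = a ∈ A × p ℕ.< 2 ℕ.* toℕ a

    lower? : ∀ a → Dec (Lower a)
    lower? a = a ∈? A ×-dec 0 ℕ.<? toℕ a ×-dec 2 ℕ.* toℕ a ℕ.<? p

    upper? : ∀ a → Dec (Upper a)
    upper? a = a ∈? A ×-dec p ℕ.<? 2 ℕ.* toℕ a

    lower upper : Subset p
    lower = select lower?
    upper = select upper?

    private
      double-+ : ∀ m n → 2 ℕ.* (m ℕ.+ n) ≡ 2 ℕ.* m ℕ.+ 2 ℕ.* n
      double-+ m n = ℕ.*-distribˡ-+ 2 m n

      double : ∀ n → 2 ℕ.* n ≡ n ℕ.+ n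
      double n = cong (n ℕ.+_) (ℕ.+-identityʳ n)

      sum-of-lower : ∀ {m n} → 2 ℕ.* m ℕ.< p → 2 ℕ.* n ℕ.< p → m ℕ.+ n ℕ.< p
      sum-of-lower {m} {n} 2m<p 2n<p = ℕ.*-cancelˡ-< 2 (m ℕ.+ n) p (begin-strict
        2 ℕ.* (m ℕ.+ n)         ≡⟨ double-+ m n ⟩
        2 ℕ.* m ℕ.+ 2 ℕ.* n     <⟨ ℕ.+-mono-< 2m<p 2n<p ⟩
        p ℕ.+ p                 ≡⟨ double p ⟨
        2 ℕ.* p                 ∎)
        where open ℕ.≤-Reasoning

      sum-of-upper : ∀ {m n} → p ℕ.< 2 ℕ.* m → p ℕ.< 2 ℕ.* n → p ℕ.< m ℕ.+ n
      sum-of-upper {m} {n} p<2m p<2n = ℕ.*-cancelˡ-< 2 p (m ℕ.+ n) (begin-strict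
        2 ℕ.* p                 ≡⟨ double p ⟩
        p ℕ.+ p                 <⟨ ℕ.+-mono-< p<2m p<2n ⟩
        2 ℕ.* m ℕ.+ 2 ℕ.* n     ≡⟨ double-+ m n ⟨
        2 ℕ.* (m ℕ.+ n)         ∎)
        where open ℕ.≤-Reasoning

      p≡1*p : p ≡ 1 ℕ.* p
      p≡1*p = sym (ℕ.*-identityˡ p)

    lower-zero-sum-free : ZeroSumFree lower
    lower-zero-sum-free {a} {a'} a∈ a'∈ with ∈-select⁻ lower? a∈ | ∈-select⁻ lower? a'∈
    ... | _ , 0<a , 2a<p | _ , _ , 2a'<p =
      ≉0-between-multiples 0 (ℕ.<-≤-trans 0<a (ℕ.m≤m+n (toℕ a) (toℕ a')))
                             (subst (toℕ a ℕ.+ toℕ a' ℕ.<_) p≡1*p (sum-of-lower {toℕ a} {toℕ a'} 2a<p 2a'<p))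

    upper-zero-sum-free : ZeroSumFree upper
    upper-zero-sum-free {a} {a'} a∈ a'∈ with ∈-select⁻ upper? a∈ | ∈-select⁻ upper? a'∈
    ... | _ , p<2a | _ , p<2a' =
      ≉0-between-multiples 1 (subst (ℕ._< toℕ a ℕ.+ toℕ a') p≡1*p (sum-of-upper {toℕ a} {toℕ a'} p<2a p<2a'))
                   (subst (toℕ a ℕ.+ toℕ a' ℕ.<_) (sym (double p)) (ℕ.+-mono-< (toℕ<n a) (toℕ<n a')))

    private
      Zero : Fin p → Set
      Zero a = toℕ a ≡ 0

      zero? : ∀ a → Dec (Zero a)
      zero? a = toℕ a ℕ.≟ 0

      covered : ∀ {a} → a ∈ A → Lower a ⊎ Upper a ⊎ Zero a
      covered {a} a∈A with zero? a
      ... | yes a≡0 = inj₂ (inj₂ a≡0)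
      ... | no  a≢0 with ℕ.<-cmp (2 ℕ.* toℕ a) p
      ...   | tri< 2a<p _ _ = inj₁ (a∈A , ℕ.n≢0⇒n>0 a≢0 , 2a<p)
      ...   | tri≈ _ 2a≡p _ = contradiction 2a≡p (p-odd a)
      ...   | tri> _ _ p<2a = inj₂ (inj₁ (a∈A , p<2a))

      𝟙-select-≥1 : ∀ {P : Fin p → Set} (P? : ∀ a → Dec (P a)) {a} → P a → 1ℤ ≤ 𝟙 (select P?) a
      𝟙-select-≥1 P? {a} Pa = ℤ.≤-reflexive (sym (trans (𝟙-select P? a) (𝕀-yes (P? a) Pa)))

      𝟙-covered : ∀ a → 𝟙 A a ≤ 𝟙 lower a + 𝟙 upper a + 𝕀 (zero? a)
      𝟙-covered a with a ∈? A
      ... | no _    = ℤ.+-mono-≤ (ℤ.+-mono-≤ (𝕀-nonneg (a ∈? lower)) (𝕀-nonneg (a ∈? upper))) (𝕀-nonneg (zero? a))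
      ... | yes a∈A with covered a∈A
      ...   | inj₁ a-lower        = ℤ.+-mono-≤ (ℤ.+-mono-≤ (𝟙-select-≥1 lower? a-lower) (𝕀-nonneg (a ∈? upper))) (𝕀-nonneg (zero? a))
      ...   | inj₂ (inj₁ a-upper) = ℤ.+-mono-≤ (ℤ.+-mono-≤ (𝕀-nonneg (a ∈? lower)) (𝟙-select-≥1 upper? a-upper)) (𝕀-nonneg (zero? a))
      ...   | inj₂ (inj₂ a-zero)  = ℤ.+-mono-≤ (ℤ.+-mono-≤ (𝕀-nonneg (a ∈? lower)) (𝕀-nonneg (a ∈? upper))) (ℤ.≤-reflexive (sym (𝕀-yes (zero? a) a-zero)))

      at-most-one-zero : ∑[ a < p ] 𝕀 (zero? a) ≤ 1ℤ
      at-most-one-zero = ∑-≤1 (λ a → 𝕀 (zero? a)) (λ a → 𝕀-≤1 (zero? a))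
        λ a a' a-zero a'-zero → toℕ-injective (trans (𝕀-pos (zero? a) a-zero) (sym (𝕀-pos (zero? a') a'-zero)))

    ∣A∣≤ : ∣ A ∣ ℕ.≤ ∣ lower ∣ ℕ.+ ∣ upper ∣ ℕ.+ 1
    ∣A∣≤ = ℤ.drop‿+≤+ (begin
      + ∣ A ∣                                                ≡⟨ ∑-𝟙 A ⟨
      ∑[ a < p ] 𝟙 A a                                       ≤⟨ ∑-mono-≤ 𝟙-covered ⟩
      ∑[ a < p ] (𝟙 lower a + 𝟙 upper a + 𝕀 (zero? a))
        ≡⟨ trans (∑-distrib-+ (λ a → 𝟙 lower a + 𝟙 upper a) (λ a → 𝕀 (zero? a)))
                 (cong (_+ ∑[ a < p ] 𝕀 (zero? a)) (trans (∑-distrib-+ (𝟙 lower) (𝟙 upper)) (cong₂ _+_ (∑-𝟙 lower) (∑-𝟙 upper)))) ⟩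
      + ∣ lower ∣ + + ∣ upper ∣ + ∑[ a < p ] 𝕀 (zero? a)    ≤⟨ ℤ.+-monoʳ-≤ (+ ∣ lower ∣ + + ∣ upper ∣) at-most-one-zero ⟩
      + (∣ lower ∣ ℕ.+ ∣ upper ∣ ℕ.+ 1)                       ∎)
      where open ℤ.≤-Reasoning

    private
      double-bound : ∀ {s m} → s ℕ.≤ m ℕ.+ m → s ℕ.+ 1 ℕ.≤ 2 ℕ.* m ℕ.+ 1
      double-bound {s} {m} s≤2m = ℕ.+-monoˡ-≤ 1 (subst (s ℕ.≤_) (sym (double m)) s≤2m)

    large-zero-sum-free-subset : Σ (Subset p) λ W → W ⊆ A × ZeroSumFree W × ∣ A ∣ ℕ.≤ 2 ℕ.* ∣ W ∣ ℕ.+ 1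
    large-zero-sum-free-subset with ℕ.≤-total ∣ lower ∣ ∣ upper ∣
    ... | inj₁ l≤u = upper , proj₁ ∘ ∈-select⁻ upper? , upper-zero-sum-free , ℕ.≤-trans ∣A∣≤ (double-bound {m = ∣ upper ∣} (ℕ.+-monoˡ-≤ ∣ upper ∣ l≤u))
    ... | inj₂ u≤l = lower , proj₁ ∘ ∈-select⁻ lower? , lower-zero-sum-free , ℕ.≤-trans ∣A∣≤ (double-bound {m = ∣ lower ∣} (ℕ.+-monoʳ-≤ ∣ lower ∣ u≤l))

  -- The main estimate

  odd-prime : ∀ {p} → Prime p → 2 ℕ.< p → ∀ n → 2 ℕ.* n ≢ p
  odd-prime (prime not-composite) 2<p n 2n≡p = not-composite (composite 2<p (ℕ∣.divides n (trans (sym 2n≡p) (ℕ.*-comm 2 n))))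

  private
    pos-*³ : ∀ a b c → + (a ℕ.* b ℕ.* c) ≡ + a * + b * + c
    pos-*³ a b c = trans (ℤ.pos-* (a ℕ.* b) c) (cong (_* + c) (ℤ.pos-* a b))

    square-abs : ∀ x → x * x ≡ + (∣ x ∣ᶻ ℕ.* ∣ x ∣ᶻ)
    square-abs (+ n)    = sym (ℤ.pos-* n n)
    square-abs -[1+ n ] = refl

    ≤-abs : ∀ x → x ≤ + ∣ x ∣ᶻ
    ≤-abs (+ n)    = ℤ.≤-refl
    ≤-abs -[1+ n ] = -≤+

  natural-bounds : ∀ {p B K C} {S G E : ℤ} → S ≡ - (+ B * + K * + C) → 0ℤ ≤ G →
    S * S ≤ + B * (+ K * G + E) → E * E ≤ + K * + K * (+ p * G * G) → G ≤ + p * + p * + C →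
    B ℕ.* K ℕ.* C ℕ.* (B ℕ.* K ℕ.* C) ℕ.≤ B ℕ.* K ℕ.* ∣ G ∣ᶻ ℕ.+ B ℕ.* ∣ E ∣ᶻ ×
    ∣ E ∣ᶻ ℕ.* ∣ E ∣ᶻ ℕ.≤ K ℕ.* K ℕ.* (p ℕ.* ∣ G ∣ᶻ ℕ.* ∣ G ∣ᶻ) ×
    ∣ G ∣ᶻ ℕ.≤ p ℕ.* p ℕ.* C
  natural-bounds {p} {B} {K} {C} {S} {G} {E} S≡ G≥0 S²≤ E²≤ G≤ = P²≤ , e²≤ , g≤
    where
    g e : ℕ
    g = ∣ G ∣ᶻ
    e = ∣ E ∣ᶻ
    G≡g : G ≡ + g
    G≡g = sym (ℤ.0≤i⇒+∣i∣≡i G≥0)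
    P²≤ : B ℕ.* K ℕ.* C ℕ.* (B ℕ.* K ℕ.* C) ℕ.≤ B ℕ.* K ℕ.* g ℕ.+ B ℕ.* e
    P²≤ = ℤ.drop‿+≤+ (begin
      + (B ℕ.* K ℕ.* C ℕ.* (B ℕ.* K ℕ.* C))  ≡⟨ trans (ℤ.pos-* (B ℕ.* K ℕ.* C) _) (cong₂ _*_ (pos-*³ B K C) (pos-*³ B K C)) ⟩
      + B * + K * + C * (+ B * + K * + C)    ≡⟨ trans (cong (λ s → s * s) S≡) (neg-square (+ B * + K * + C)) ⟨
      S * S                                   ≤⟨ S²≤ ⟩
      + B * (+ K * G + E)                     ≡⟨ cong (λ t → + B * (+ K * t + E)) G≡g ⟩
      + B * (+ K * + g + E)                   ≤⟨ ℤ.*-monoˡ-≤-nonNeg (+ B) (ℤ.+-monoʳ-≤ (+ K * + g) (≤-abs E)) ⟩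
      + B * (+ K * + g + + e)                 ≡⟨ trans (ℤ.pos-+ (B ℕ.* K ℕ.* g) (B ℕ.* e))
                                                   (trans (cong₂ _+_ (pos-*³ B K g) (ℤ.pos-* B e)) (distrib (+ B) (+ K) (+ g) (+ e))) ⟨
      + (B ℕ.* K ℕ.* g ℕ.+ B ℕ.* e)           ∎)
      where
      open ℤ.≤-Reasoning
      neg-square : ∀ x → - x * - x ≡ x * x
      neg-square = solve-∀
      distrib : ∀ b k g e → b * k * g + b * e ≡ b * (k * g + e)
      distrib = solve-∀
    e²≤ : e ℕ.* e ℕ.≤ K ℕ.* K ℕ.* (p ℕ.* g ℕ.* g)
    e²≤ = ℤ.drop‿+≤+ (begin
      + (e ℕ.* e)                            ≡⟨ square-abs E ⟨
      E * E                                  ≤⟨ E²≤ ⟩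
      + K * + K * (+ p * G * G)              ≡⟨ cong (λ t → + K * + K * (+ p * t * t)) G≡g ⟩
      + K * + K * (+ p * + g * + g)          ≡⟨ trans (ℤ.pos-* (K ℕ.* K) (p ℕ.* g ℕ.* g)) (cong₂ _*_ (ℤ.pos-* K K) (pos-*³ p g g)) ⟨
      + (K ℕ.* K ℕ.* (p ℕ.* g ℕ.* g))        ∎)
      where open ℤ.≤-Reasoning
    g≤ : g ℕ.≤ p ℕ.* p ℕ.* C
    g≤ = ℤ.drop‿+≤+ (subst₂ _≤_ G≡g (sym (pos-*³ p p C)) G≤)

  module MainEstimate (p : ℕ) (p-prime : Prime p) (A₁ A₂ A₃ : Subset p) where
    open ZMod p p-prime

    Unsolvable : Set
    Unsolvable = ∀ {a₁ a₂ a₃} → a₁ ∈ A₁ → a₂ ∈ A₂ → a₃ ∈ A₃ → ⟦ a₁ ⟧ * ⟦ a₁ ⟧ + ⟦ a₁ ⟧ * ⟦ a₂ ⟧ + ⟦ a₃ ⟧ ≉ 0ℤ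

    unsolvable⇒few-points : 2 ℕ.< p → Unsolvable → ∣ A₁ ∣ ℕ.* ∣ A₂ ∣ ℕ.* ∣ A₃ ∣ ℕ.* (∣ A₁ ∣ ℕ.* ∣ A₂ ∣ ℕ.* ∣ A₃ ∣) ℕ.< 1600 ℕ.* p ^ 5
    unsolvable⇒few-points 2<p unsolvable with Halves.large-zero-sum-free-subset p p-prime (odd-prime p-prime 2<p ∘ toℕ) A₁
    ... | W , W⊆A₁ , W-zero-sum-free , ∣A₁∣≤ =
      let open Counting p p-prime W A₂ A₃
          unsolvable-W : ∀ {a x u} → a ∈ W → x ∈ A₂ → u ∈ A₃ → ⟦ a ⟧ * ⟦ a ⟧ + ⟦ a ⟧ * ⟦ x ⟧ + ⟦ u ⟧ ≉ 0ℤ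
          unsolvable-W a∈W = unsolvable (W⊆A₁ a∈W)
          (P²≤ , e²≤ , g≤) = natural-bounds {p} {B} {K} {C} (S≡ W-zero-sum-free unsolvable-W) ‖g‖²-nonneg
                               (subst (S * S ≤_) (cong (+ B *_) (∑T² W-zero-sum-free unsolvable-W)) (cs₁ W-zero-sum-free unsolvable-W))
                               (cs₂ W-zero-sum-free unsolvable-W) ‖g‖²-≤
      in product-bound {{prime⇒nonZero p-prime}} {B} {K} {C} {∣ A₁ ∣} P²≤ e²≤ g≤ ∣A₁∣≤ (∣p∣≤n A₂) (∣p∣≤n A₃)

    ≈0⇒eqnValue≡0 : ∀ a₁ a₂ a₃ → ⟦ a₁ ⟧ * ⟦ a₁ ⟧ + ⟦ a₁ ⟧ * ⟦ a₂ ⟧ + ⟦ a₃ ⟧ ≈ 0ℤ → eqnValue p a₁ a₂ a₃ ≡ 0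
    ≈0⇒eqnValue≡0 a₁ a₂ a₃ ≈0 = ℕ∣.n∣m⇒m%n≡0 _ p (subst (p ℕ∣.∣_) (cong ∣_∣ᶻ (sym as-integer)) (∣⇒∣ᵤ (≈0⇒∣ ≈0)))
      where
      as-integer : + (toℕ a₁ ^ 2 ℕ.+ toℕ a₁ ℕ.* toℕ a₂ ℕ.+ toℕ a₃) ≡ ⟦ a₁ ⟧ * ⟦ a₁ ⟧ + ⟦ a₁ ⟧ * ⟦ a₂ ⟧ + ⟦ a₃ ⟧
      as-integer = begin
        + (toℕ a₁ ^ 2 ℕ.+ toℕ a₁ ℕ.* toℕ a₂ ℕ.+ toℕ a₃)       ≡⟨ ℤ.pos-+ (toℕ a₁ ^ 2 ℕ.+ toℕ a₁ ℕ.* toℕ a₂) (toℕ a₃) ⟩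
        + (toℕ a₁ ^ 2 ℕ.+ toℕ a₁ ℕ.* toℕ a₂) + ⟦ a₃ ⟧         ≡⟨ cong (_+ ⟦ a₃ ⟧) (ℤ.pos-+ (toℕ a₁ ^ 2) (toℕ a₁ ℕ.* toℕ a₂)) ⟩
        + (toℕ a₁ ^ 2) + + (toℕ a₁ ℕ.* toℕ a₂) + ⟦ a₃ ⟧       ≡⟨ cong (λ n → + (toℕ a₁ ℕ.* n) + + (toℕ a₁ ℕ.* toℕ a₂) + ⟦ a₃ ⟧)
                                                                   (ℕ.*-identityʳ (toℕ a₁)) ⟩
        + (toℕ a₁ ℕ.* toℕ a₁) + + (toℕ a₁ ℕ.* toℕ a₂) + ⟦ a₃ ⟧ ≡⟨ cong (_+ ⟦ a₃ ⟧) (cong₂ _+_ (ℤ.pos-* (toℕ a₁) (toℕ a₁)) (ℤ.pos-* (toℕ a₁) (toℕ a₂))) ⟩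
        ⟦ a₁ ⟧ * ⟦ a₁ ⟧ + ⟦ a₁ ⟧ * ⟦ a₂ ⟧ + ⟦ a₃ ⟧             ∎
        where open ≡-Reasoning

open import Defs using (eqnValue)
open import Data.Nat using (ℕ; _*_; _^_; _≤_; NonZero)
open import Data.Nat.Primality using (Prime; prime⇒nonZero)
open import Data.Fin using (Fin)
open import Data.Fin.Subset using (Subset; _∈_; ∣_∣)
open import Data.Product using (Σ; _×_; _,_)
open import Relation.Binary.PropositionalEquality using (_≡_; subst; cong)
import Data.Nat as ℕ
import Data.Nat.Properties as ℕ
open import Data.Fin.Properties using (any?)
open import Data.Fin.Subset.Properties using (_∈?_; ∣p∣≤n)
open import Data.Empty using (⊥-elim)
open import Relation.Nullary using (yes; no)
open import Relation.Nullary.Decidable using (_×-dec_)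
open NaturalBounds using (1600≤p)
open Proof using (module MainEstimate)

mainTheorem2 : (p : ℕ) → (pr : Prime p) → (A₁ A₂ A₃ : Subset p) →
    1600 * p ^ 5 ≤ (∣ A₁ ∣ * ∣ A₂ ∣ * ∣ A₃ ∣) ^ 2 →
    Σ (Fin p) λ a₁ → Σ (Fin p) λ a₂ → Σ (Fin p) λ a₃ →
      a₁ ∈ A₁ × a₂ ∈ A₂ × a₃ ∈ A₃ ×
      eqnValue p {{prime⇒nonZero pr}} a₁ a₂ a₃ ≡ 0
mainTheorem2 p pr A₁ A₂ A₃ many-points
  with any? (λ a₁ → any? (λ a₂ → any? (λ a₃ →
         a₁ ∈? A₁ ×-dec a₂ ∈? A₂ ×-dec a₃ ∈? A₃ ×-dec eqnValue p {{prime⇒nonZero pr}} a₁ a₂ a₃ ℕ.≟ 0)))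
... | yes solution   = solution
... | no no-solution = ⊥-elim (ℕ.<⇒≱ (unsolvable⇒few-points 2<p unsolvable) N²≥)
  where
  instance
    p≢0 : NonZero p
    p≢0 = prime⇒nonZero pr
  open MainEstimate p pr A₁ A₂ A₃
  N : ℕ
  N = ∣ A₁ ∣ * ∣ A₂ ∣ * ∣ A₃ ∣
  N²≥ : 1600 * p ^ 5 ≤ N * N
  N²≥ = subst (1600 * p ^ 5 ≤_) (cong (N *_) (ℕ.*-identityʳ N)) many-points
  2<p : 2 ℕ.< p
  2<p = ℕ.<-≤-trans (ℕ.m≤m+n 3 1597) (1600≤p (ℕ.*-mono-≤ (ℕ.*-mono-≤ (∣p∣≤n A₁) (∣p∣≤n A₂)) (∣p∣≤n A₃)) N²≥)
  unsolvable : Unsolvable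
  unsolvable {a₁} {a₂} {a₃} a₁∈ a₂∈ a₃∈ ≈0 = no-solution (a₁ , a₂ , a₃ , a₁∈ , a₂∈ , a₃∈ , ≈0⇒eqnValue≡0 a₁ a₂ a₃ ≈0)
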